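{- Let $G$ be a finite simple graph and let $v \in V(G)$ be a vertex such that $\{v\} \subsetneq N_G[v] \subsetneq V(G)$ and $N_G[v]$ is a clique. Let $k$ be the number of universal vertices of $G$. For every $u \in N_G(v)$, let $\mathcal{V}_u$ be an acyclic matching on $\mathcal{I}(G - N_G[u])$. Then there is an acyclic matching $\mathcal{V}$ on $\mathcal{I}(G)$ such that (i) $f_0^{\mathcal{V}}(\mathcal{I}(G)) = 1 + k$, which equals the number of connected components of $\mathcal{I}(G)$; (ii) $f_1^{\mathcal{V}}(\mathcal{I}(G)) = \sum_{u \in N_G(v)} f_0^{\mathcal{V}_u}(\mathcal{I}(G - N_G[u])) - (|N_G(v)| - k)$; (iii) for every $t \geq 2$, $f_t^{\mathcal{V}}(\mathcal{I}(G)) = \sum_{u \in N_G(v)} f_{t-1}^{\mathcal{V}_u}(\mathcal{I}(G - N_G[u]))$.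
   Context: Graphs are finite, simple and undirected. $N_G(v)$ is the set of neighbours of $v$ and $N_G[v] = N_G(v) \sqcup \{v\}$. A vertex is universal if it is adjacent to all other vertices. For $U \subseteq V(G)$, $G - U$ is the subgraph induced on $V(G)\setminus U$ (possibly the empty graph). The independence complex $\mathcal{I}(G)$ is the abstract simplicial complex whose simplices are the independent sets of $G$ (including $\emptyset$); a simplex with $d+1$ elements has dimension $d$. An acyclic matching on a simplicial complex $\mathcal{X}$ is a set $\mathcal{V}$ of pairs $(\alpha,\beta)$ of simplices of $\mathcal{X}$ with $\alpha \subseteq \beta$ and $\dim\beta = \dim\alpha + 1$ (the empty simplex may occur, with dimension $-1$), each simplex appearing in at most one pair, such that the directed graph obtained from the Hasse diagram of $\mathcal{X}$ (edges $\beta \to \alpha$ for codimension-one faces $\alpha\subsetneq\beta$) by reversing the edges in $\mathcal{V}$ has no directed cycle. A non-empty simplex is $\mathcal{V}$-critical if it is not in any pair of $\mathcal{V}$ or is paired with $\emptyset$. $f_d^{\mathcal{V}}(\mathcal{X})$ denotes the number of $d$-dimensional $\mathcal{V}$-critical simplices. -}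

module Defs where

open import Data.Bool using (Bool; true; false; if_then_else_)
open import Data.Bool.Properties using () renaming (_≟_ to _≟ᵇ_)
open import Data.Nat using (ℕ; zero; suc; _+_)
open import Data.Fin using (Fin)
open import Data.Fin.Properties using (all?)
open import Data.Fin.Subset using (Subset; _∈_; _∉_; _⊆_; _∪_; ∁; ⁅_⁆; ⊥; ⊤; ∣_∣)
open import Data.Fin.Subset.Properties using (_∈?_; _⊆?_)
open import Data.Vec using (Vec; []; _∷_; tabulate)
open import Data.Vec.Properties using (≡-dec)
open import Data.List using (List; length; lookup; filter; allFin)
open import Data.List.Membership.Propositional using () renaming (_∈_ to _∈ₗ_)
open import Data.List.Membership.DecPropositional using () renaming (_∈?_ to _∈ₗ?_)
open import Data.List.Relation.Unary.All using (All)
open import Data.List.Relation.Unary.All as All using ()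
open import Data.List.Relation.Unary.Any using (Any)
open import Data.Product using (Σ; _×_; _,_; ∃; proj₁; proj₂)
open import Data.Product.Properties using () renaming (≡-dec to ≡-dec×)
open import Data.Sum using (_⊎_)
open import Data.Empty using () renaming (⊥ to Empty)
open import Relation.Nullary using (¬_; Dec; yes; no; does)
open import Relation.Nullary.Decidable using (_×-dec_; _⊎-dec_; _→-dec_; ¬?)
open import Relation.Unary using (Decidable)
open import Relation.Binary.PropositionalEquality using (_≡_; _≢_)
open import Relation.Binary.Construct.Closure.Transitive using (TransClosure)
open import Relation.Binary.Construct.Closure.ReflexiveTransitive using (Star)
open import Function.Bundles using (_⇔_)

record Graph (n : ℕ) : Set where
  field
    adj    : Fin n → Fin n → Bool
    symm   : ∀ a b → adj a b ≡ adj b a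
    irrefl : ∀ a → adj a a ≡ false
open Graph public

module _ {n : ℕ} (G : Graph n) where

  Adj : Fin n → Fin n → Set
  Adj a b = adj G a b ≡ true

  N : Fin n → Subset n
  N v = tabulate (adj G v)

  Nc : Fin n → Subset n
  Nc v = ⁅ v ⁆ ∪ N v

  IsClique : Subset n → Set
  IsClique S = ∀ a b → a ∈ S → b ∈ S → a ≢ b → Adj a b

  Universal : Fin n → Set
  Universal u = ∀ w → w ≢ u → Adj u w

  universal? : Decidable Universal
  universal? u = all? (λ w → ¬? (w Data.Fin.≟ u) →-dec (adj G u w ≟ᵇ true))
    where import Data.Fin

  Independent : Subset n → Set
  Independent σ = ∀ a b → a ∈ σ → b ∈ σ → adj G a b ≡ false

countFin : ∀ {n} {P : Fin n → Set} → Decidable P → ℕ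
countFin {n} P? = length (filter P? (allFin n))

countSub : ∀ n {P : Subset n → Set} → Decidable P → ℕ
countSub zero    P? = if does (P? []) then 1 else 0
countSub (suc n) P? = countSub n (λ σ → P? (false ∷ σ)) + countSub n (λ σ → P? (true ∷ σ))

sumOver : ∀ {n} → Subset n → (Fin n → ℕ) → ℕ
sumOver {zero}  []      f = 0
sumOver {suc n} (b ∷ S) f =
  (if b then f Data.Fin.zero else 0) + sumOver S (λ i → f (Data.Fin.suc i))
  where import Data.Fin

record Complex (n : ℕ) : Set₁ where
  field
    Face  : Subset n → Set
    face? : Decidable Face
open Complex public

-- The independence complex I(G - U) of the induced subgraph G - U,
-- realised on the vertex set V(G) \ U ⊆ Fin n: its simplices are the
-- independent sets of G contained in V(G) \ U.
Ind : ∀ {n} → Graph n → Subset n → Complex n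
Face  (Ind G U) σ = σ ⊆ ∁ U × Independent G σ
face? (Ind G U) σ =
  (σ ⊆? ∁ U) ×-dec
  all? (λ a → all? (λ b → (a ∈? σ) →-dec ((b ∈? σ) →-dec (adj G a b ≟ᵇ false))))

I[_-_] : ∀ {n} → Graph n → Subset n → Complex n
I[ G - U ] = Ind G U

I : ∀ {n} → Graph n → Complex n
I G = Ind G ⊥

Pair : ℕ → Set
Pair n = Subset n × Subset n

Matching : ℕ → Set
Matching n = List (Pair n)

_≟ˢ_ : ∀ {n} (σ τ : Subset n) → Dec (σ ≡ τ)
_≟ˢ_ = ≡-dec _≟ᵇ_

InPair : ∀ {n} → Subset n → Pair n → Set
InPair σ (α , β) = σ ≡ α ⊎ σ ≡ β

Share : ∀ {n} → Pair n → Pair n → Set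
Share (α , β) q = InPair α q ⊎ InPair β q

module _ {n : ℕ} (X : Complex n) where

  -- α is a codimension-one face of β in X (an edge β → α of the Hasse diagram)
  CodimOne : Subset n → Subset n → Set
  CodimOne α β = Face X α × Face X β × α ⊆ β × ∣ β ∣ ≡ suc ∣ α ∣

  -- edges of the Hasse diagram with the edges of V reversed
  Step : Matching n → Subset n → Subset n → Set
  Step V σ τ = (CodimOne τ σ × ¬ ((τ , σ) ∈ₗ V)) ⊎ ((σ , τ) ∈ₗ V)

  IsAcyclicMatching : Matching n → Set
  IsAcyclicMatching V =
      All (λ p → CodimOne (proj₁ p) (proj₂ p)) V
    × (∀ i j → Share (lookup V i) (lookup V j) → i ≡ j)
    × (∀ σ → ¬ TransClosure (Step V) σ σ)

  Critical : Matching n → Subset n → Set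
  Critical V σ = σ ≢ ⊥ × Face X σ × (All (λ p → ¬ InPair σ p) V ⊎ (⊥ , σ) ∈ₗ V)

  critical? : (V : Matching n) → Decidable (Critical V)
  critical? V σ =
    ¬? (σ ≟ˢ ⊥) ×-dec face? X σ ×-dec
    (All.all? (λ p → ¬? ((σ ≟ˢ proj₁ p) ⊎-dec (σ ≟ˢ proj₂ p))) V
      ⊎-dec _∈ₗ?_ (≡-dec× _≟ˢ_ _≟ˢ_) (⊥ , σ) V)

  -- f_d^V(X): number of d-dimensional (i.e. (d+1)-element) V-critical simplices
  f : Matching n → ℕ → ℕ
  f V d = countSub n (λ σ → critical? V σ ×-dec (∣ σ ∣ Data.Nat.≟ suc d))
    where import Data.Nat

  Linked : Fin n → Fin n → Set
  Linked x y = Face X (⁅ x ⁆ ∪ ⁅ y ⁆)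

  IsVertex : Fin n → Set
  IsVertex x = Face X ⁅ x ⁆

  -- X has exactly c connected components: there is a surjective labelling
  -- of the vertices of X by Fin c whose fibres are exactly the classes of
  -- connectivity in the 1-skeleton.
  HasComponents : ℕ → Set
  HasComponents c =
    Σ (Fin n → Fin c) λ comp →
        (∀ x y → IsVertex x → IsVertex y → (comp x ≡ comp y ⇔ Star Linked x y))
      × (∀ i → ∃ λ x → IsVertex x × comp x ≡ i)

N[_,_] : ∀ {n} → Graph n → Fin n → Subset n
N[ G , v ] = Nc G v

-- Write X_u = I(G - N[u]) for u ∈ N(v). Since N[v] is a clique, an independent set σ meets N(v) in at most one
-- vertex u, and then σ ∖ {u} ∈ X_u. First complete each 𝒱_u by pairing ∅ with an unmatched vertex of X_u when both
-- ∅ and such a vertex are unmatched. Then V pairs σ with σ ∪ {v} when σ misses N(v), and pairs σ ∪ {u} with τ ∪ {u}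
-- when (σ , τ) is a pair of the completed 𝒱_u. A cycle through simplices containing u projects to a cycle of the
-- completed 𝒱_u, and on simplices missing N(v) the weight 2|σ| + 3[v ∉ σ] strictly decreases, so V is acyclic.
-- The critical simplices of V are {v} (paired with ∅) and τ ∪ {u} with τ unmatched in the completed 𝒱_u. If X_u has
-- a vertex, i.e. u is not universal, ∅ ends up matched and exactly one critical vertex of 𝒱_u (the partner of ∅)
-- is not unmatched; if u is universal, X_u = {∅} and ∅ stays unmatched. Summing over u gives (i)-(iii).
-- In I(G) the universal vertices are isolated, and every other vertex is joined to v by a path of length at most 2.

module Submission where

open import Defs
open import Data.Bool using (true; false)
open import Data.Bool.Properties using (¬-not) renaming (_≟_ to _≟ᵇ_)
open import Data.Empty using (⊥-elim)
open import Data.Fin using (Fin; zero; suc; toℕ) renaming (_≟_ to _≟ᶠ_)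
open import Data.Fin.Properties using (any?; pigeonhole)
import Data.Fin.Properties as Finₚ
open import Data.Fin.Subset using (Subset; inside; outside; _∈_; _∉_; _⊆_; _⊂_; ⊥; ⊤; ⁅_⁆; _∪_; ∁; ∣_∣; Nonempty)
open import Data.Fin.Subset.Properties
  using (_∈?_; Empty-unique; nonempty?; drop-there; drop-∷-⊆; p⊆q⇒∣p∣≤∣q∣; ∣⊥∣≡0; ∉⊥; ⊥⊆; x∈⁅x⁆; x∈⁅y⁆⇒x≡y; ∣⁅x⁆∣≡1;
         x∈p∪q⁺; x∈p∪q⁻; x∈∁p⇒x∉p; x∉p⇒x∈∁p)
open import Data.Integer using (ℤ; +_; _-_)
import Data.Integer as ℤ
open import Data.Integer.Properties using (pos-+)
open import Data.Integer.Tactic.RingSolver using (solve-∀)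
open import Data.List using (List; []; _∷_; map; _++_; filter; cartesianProduct; allFin; length; lookup; tabulate)
open import Data.List.Membership.DecPropositional using () renaming (_∈?_ to ∈ₗ-dec)
open import Data.List.Membership.Propositional using (find) renaming (_∈_ to _∈ₗ_)
open import Data.List.Membership.Propositional.Properties
  using (∈-lookup; ∈-map⁺; ∈-map⁻; ∈-++⁺ˡ; ∈-++⁺ʳ; ∈-filter⁺; ∈-filter⁻; ∈-cartesianProduct⁺; ∈-allFin)
open import Data.List.Membership.Setoid.Properties using (index-injective)
open import Data.List.Relation.Unary.All using (All; _∷_)
import Data.List.Relation.Unary.All as All
open import Data.List.Relation.Unary.All.Properties using (¬Any⇒All¬; all-filter)
open import Data.List.Relation.Unary.AllPairs using ([]; _∷_)
open import Data.List.Relation.Unary.Any using (index)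
import Data.List.Relation.Unary.Any as Any
open import Data.List.Relation.Unary.Any.Properties using (lookup-index)
open import Data.List.Relation.Unary.Unique.Propositional using (Unique)
import Data.List.Relation.Unary.Unique.Propositional.Properties as Unique
open import Data.Nat using (ℕ; zero; suc; _+_; _*_; _∸_; _<_; _≤_; s≤s; z≤n; s≤s⁻¹) renaming (_≟_ to _≟ℕ_)
open import Data.Nat.Properties
  using (module ≤-Reasoning; suc-injective; 0≢1+n; 1+n≰n; +-comm; ≤-trans; ≤-reflexive; <-irrefl; <-trans;
         +-monoʳ-<; m<n⇒m<1+n; n<1+n; m<1+n⇒m<n∨m≡n; +-commutativeSemigroup)
open import Algebra.Properties.CommutativeSemigroup +-commutativeSemigroup using (interchange)
open import Data.Product using (Σ; ∃; _×_; _,_; proj₁; proj₂)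
open import Data.Product.Properties using () renaming (≡-dec to ≡-dec×)
open import Data.Sum using (_⊎_; inj₁; inj₂)
open import Data.Vec using ([]; _∷_; _[_]≔_; here; there)
open import Data.Vec.Properties using (∷-injectiveʳ; lookup∘tabulate; []=⇒lookup; lookup⇒[]=)
open import Function using (_∘_; id; case_of_)
open import Function.Bundles using (_⇔_; mk⇔; Equivalence)
open import Function.Properties.Equivalence using () renaming (sym to ⇔-sym)
open import Relation.Binary.Construct.Closure.ReflexiveTransitive using (Star; ε; _◅_; _◅◅_; reverse)
open import Relation.Binary.Construct.Closure.Transitive using (TransClosure; [_]; _∷_) renaming (_++_ to _++⁺_)
open import Relation.Binary.PropositionalEquality
  using (_≡_; _≢_; refl; sym; trans; cong; cong₂; subst; subst₂; setoid; module ≡-Reasoning)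
open import Relation.Nullary using (¬_; Dec; yes; no)
open import Relation.Nullary.Decidable using (_×-dec_; _⊎-dec_; ¬?)
open import Relation.Unary using (Decidable)

open Equivalence using (to; from)

private variable
  m n : ℕ

insert remove : Fin n → Subset n → Subset n
insert x p = p [ x ]≔ inside
remove x p = p [ x ]≔ outside

x∈insert : ∀ x (p : Subset n) → x ∈ insert x p
x∈insert zero    (_ ∷ p) = here
x∈insert (suc x) (_ ∷ p) = there (x∈insert x p)

p⊆insert : ∀ x (p : Subset n) → p ⊆ insert x p
p⊆insert zero    (_ ∷ p) here       = here
p⊆insert zero    (_ ∷ p) (there y∈) = there y∈
p⊆insert (suc x) (_ ∷ p) here       = here
p⊆insert (suc x) (_ ∷ p) (there y∈) = there (p⊆insert x p y∈)

∈insert⁻ : ∀ x (p : Subset n) {y} → y ∈ insert x p → y ≡ x ⊎ y ∈ p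
∈insert⁻ zero    (_ ∷ p) here       = inj₁ refl
∈insert⁻ zero    (_ ∷ p) (there y∈) = inj₂ (there y∈)
∈insert⁻ (suc x) (_ ∷ p) here       = inj₂ here
∈insert⁻ (suc x) (_ ∷ p) (there y∈) with ∈insert⁻ x p y∈
... | inj₁ refl = inj₁ refl
... | inj₂ y∈p  = inj₂ (there y∈p)

x∉remove : ∀ x (p : Subset n) → x ∉ remove x p
x∉remove zero    (_ ∷ p) ()
x∉remove (suc x) (_ ∷ p) (there x∈) = x∉remove x p x∈

remove⊆p : ∀ x (p : Subset n) → remove x p ⊆ p
remove⊆p zero    (_ ∷ p) (there y∈) = there y∈
remove⊆p (suc x) (_ ∷ p) here       = here
remove⊆p (suc x) (_ ∷ p) (there y∈) = there (remove⊆p x p y∈)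

∈remove⁺ : ∀ x (p : Subset n) {y} → y ≢ x → y ∈ p → y ∈ remove x p
∈remove⁺ zero    (_ ∷ p) y≢x here       = ⊥-elim (y≢x refl)
∈remove⁺ zero    (_ ∷ p) y≢x (there y∈) = there y∈
∈remove⁺ (suc x) (_ ∷ p) y≢x here       = here
∈remove⁺ (suc x) (_ ∷ p) y≢x (there y∈) = there (∈remove⁺ x p (y≢x ∘ cong suc) y∈)

∣insert∣ : ∀ x (p : Subset n) → x ∉ p → ∣ insert x p ∣ ≡ suc ∣ p ∣
∣insert∣ zero    (outside ∷ p) x∉ = refl
∣insert∣ zero    (inside  ∷ p) x∉ = ⊥-elim (x∉ here)
∣insert∣ (suc x) (outside ∷ p) x∉ = ∣insert∣ x p (x∉ ∘ there)
∣insert∣ (suc x) (inside  ∷ p) x∉ = cong suc (∣insert∣ x p (x∉ ∘ there))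

∣remove∣ : ∀ x (p : Subset n) → x ∈ p → ∣ p ∣ ≡ suc ∣ remove x p ∣
∣remove∣ zero    (inside  ∷ p) x∈         = refl
∣remove∣ (suc x) (outside ∷ p) (there x∈) = ∣remove∣ x p x∈
∣remove∣ (suc x) (inside  ∷ p) (there x∈) = cong suc (∣remove∣ x p x∈)

insert-remove : ∀ x (p : Subset n) → x ∈ p → insert x (remove x p) ≡ p
insert-remove zero    (inside ∷ p) x∈         = refl
insert-remove (suc x) (s ∷ p)      (there x∈) = cong (s ∷_) (insert-remove x p x∈)

remove-insert : ∀ x (p : Subset n) → x ∉ p → remove x (insert x p) ≡ p
remove-insert zero    (outside ∷ p) x∉ = refl
remove-insert zero    (inside  ∷ p) x∉ = ⊥-elim (x∉ here)
remove-insert (suc x) (s ∷ p)       x∉ = cong (s ∷_) (remove-insert x p (x∉ ∘ there))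

remove-injective : ∀ x {p q : Subset n} → x ∈ p → x ∈ q → remove x p ≡ remove x q → p ≡ q
remove-injective x {p} {q} x∈p x∈q eq =
  trans (sym (insert-remove x p x∈p)) (trans (cong (insert x) eq) (insert-remove x q x∈q))

⊆-∣∣-antisym : {p q : Subset n} → p ⊆ q → ∣ q ∣ ≤ ∣ p ∣ → p ≡ q
⊆-∣∣-antisym {p = []}          {[]}          _   _  = refl
⊆-∣∣-antisym {p = outside ∷ p} {outside ∷ q} p⊆q le = cong (outside ∷_) (⊆-∣∣-antisym (drop-∷-⊆ p⊆q) le)
⊆-∣∣-antisym {p = outside ∷ p} {inside ∷ q}  p⊆q le = ⊥-elim (1+n≰n (≤-trans le (p⊆q⇒∣p∣≤∣q∣ (drop-∷-⊆ p⊆q))))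
⊆-∣∣-antisym {p = inside ∷ p}  {outside ∷ q} p⊆q le with () ← p⊆q here
⊆-∣∣-antisym {p = inside ∷ p}  {inside ∷ q}  p⊆q le = cong (inside ∷_) (⊆-∣∣-antisym (drop-∷-⊆ p⊆q) (s≤s⁻¹ le))

nonempty : (p : Subset n) → p ≢ ⊥ → Nonempty p
nonempty p p≢⊥ with nonempty? p
... | yes ne = ne
... | no ¬ne = ⊥-elim (p≢⊥ (Empty-unique ¬ne))

∣p∣≡0⇒p≡⊥ : (p : Subset n) → ∣ p ∣ ≡ 0 → p ≡ ⊥
∣p∣≡0⇒p≡⊥ []            _   = refl
∣p∣≡0⇒p≡⊥ (outside ∷ p) ∣p∣≡0 = cong (outside ∷_) (∣p∣≡0⇒p≡⊥ p ∣p∣≡0)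

another-element : ∀ {k} x (p : Subset n) → x ∈ p → ∣ p ∣ ≡ suc (suc k) → ∃ λ y → y ∈ p × y ≢ x
another-element {n = n} x p x∈p ∣p∣≡2+k with nonempty (remove x p) remove≢⊥
  where remove≢⊥ : remove x p ≢ ⊥
        remove≢⊥ eq = 0≢1+n (trans (sym (∣⊥∣≡0 n))
                                   (trans (cong ∣_∣ (sym eq)) (suc-injective (trans (sym (∣remove∣ x p x∈p)) ∣p∣≡2+k))))
... | y , y∈ = y , remove⊆p x p y∈ , λ { refl → x∉remove x p y∈ }

remove-∉ : ∀ x (p : Subset n) → x ∉ p → remove x p ≡ p
remove-∉ zero    (outside ∷ p) _  = refl
remove-∉ zero    (inside  ∷ p) x∉ = ⊥-elim (x∉ here)
remove-∉ (suc x) (s ∷ p)       x∉ = cong (s ∷_) (remove-∉ x p (x∉ ∘ there))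

remove-mono : ∀ x {p q : Subset n} → p ⊆ q → remove x p ⊆ remove x q
remove-mono x {p} {q} p⊆q {y} y∈ with y ≟ᶠ x
... | yes refl = ⊥-elim (x∉remove x p y∈)
... | no  y≢x  = ∈remove⁺ x q y≢x (p⊆q (remove⊆p x p y∈))

allSubsets : ∀ n → List (Subset n)
allSubsets zero    = [] ∷ []
allSubsets (suc n) = map (outside ∷_) (allSubsets n) ++ map (inside ∷_) (allSubsets n)

∈-allSubsets : ∀ {n} (σ : Subset n) → σ ∈ₗ allSubsets n
∈-allSubsets []                    = Any.here refl
∈-allSubsets {suc n} (outside ∷ σ) = ∈-++⁺ˡ (∈-map⁺ (outside ∷_) (∈-allSubsets σ))
∈-allSubsets {suc n} (inside ∷ σ)  = ∈-++⁺ʳ (map (outside ∷_) (allSubsets n)) (∈-map⁺ (inside ∷_) (∈-allSubsets σ))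

allSubsets-unique : ∀ n → Unique (allSubsets n)
allSubsets-unique zero    = All.[] ∷ []
allSubsets-unique (suc n) =
  Unique.++⁺ (Unique.map⁺ ∷-injectiveʳ (allSubsets-unique n)) (Unique.map⁺ ∷-injectiveʳ (allSubsets-unique n)) disjoint
  where
  disjoint : ∀ {σ} → σ ∈ₗ map (outside ∷_) (allSubsets n) × σ ∈ₗ map (inside ∷_) (allSubsets n) → Data.Empty.⊥
  disjoint (∈₁ , ∈₂) with ∈-map⁻ (outside ∷_) ∈₁ | ∈-map⁻ (inside ∷_) ∈₂
  ... | _ , _ , refl | _ , _ , ()

countSub-cong : ∀ n {P Q : Subset n → Set} (P? : Decidable P) (Q? : Decidable Q) →
                (∀ σ → P σ ⇔ Q σ) → countSub n P? ≡ countSub n Q?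
countSub-cong zero P? Q? P⇔Q with P? [] | Q? []
... | yes _ | yes _ = refl
... | no _  | no _  = refl
... | yes p | no ¬q = ⊥-elim (¬q (to (P⇔Q []) p))
... | no ¬p | yes q = ⊥-elim (¬p (from (P⇔Q []) q))
countSub-cong (suc n) P? Q? P⇔Q =
  cong₂ _+_ (countSub-cong n _ _ (P⇔Q ∘ (outside ∷_))) (countSub-cong n _ _ (P⇔Q ∘ (inside ∷_)))

countSub-∅ : ∀ n {P : Subset n → Set} (P? : Decidable P) → (∀ σ → ¬ P σ) → countSub n P? ≡ 0
countSub-∅ zero P? ¬P with P? []
... | yes p = ⊥-elim (¬P [] p)
... | no _  = refl
countSub-∅ (suc n) P? ¬P = cong₂ _+_ (countSub-∅ n _ (¬P ∘ (outside ∷_))) (countSub-∅ n _ (¬P ∘ (inside ∷_)))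

countSub-≡ : ∀ n (τ : Subset n) → countSub n (_≟ˢ τ) ≡ 1
countSub-≡ zero    []            = refl
countSub-≡ (suc n) (outside ∷ τ) =
  cong₂ _+_ (trans (countSub-cong n _ _ (λ σ → mk⇔ ∷-injectiveʳ (cong (outside ∷_)))) (countSub-≡ n τ))
            (countSub-∅ n _ (λ σ ()))
countSub-≡ (suc n) (inside ∷ τ) =
  cong₂ _+_ (countSub-∅ n _ (λ σ ()))
            (trans (countSub-cong n _ _ (λ σ → mk⇔ ∷-injectiveʳ (cong (inside ∷_)))) (countSub-≡ n τ))

countSub-⊎ : ∀ n {P Q R : Subset n → Set} (P? : Decidable P) (Q? : Decidable Q) (R? : Decidable R) →
             (∀ σ → P σ ⇔ (Q σ ⊎ R σ)) → (∀ σ → Q σ → ¬ R σ) →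
             countSub n P? ≡ countSub n Q? + countSub n R?
countSub-⊎ n P? Q? R? P⇔Q⊎R Q∩R=∅ =
  trans (countSub-cong n P? (λ σ → Q? σ ⊎-dec R? σ) P⇔Q⊎R) (count-⊎-dec n Q? R? Q∩R=∅)
  where
  count-⊎-dec : ∀ n {Q R : Subset n → Set} (Q? : Decidable Q) (R? : Decidable R) → (∀ σ → Q σ → ¬ R σ) →
                countSub n (λ σ → Q? σ ⊎-dec R? σ) ≡ countSub n Q? + countSub n R?
  count-⊎-dec zero Q? R? disj with Q? [] | R? []
  ... | yes q | yes r = ⊥-elim (disj [] q r)
  ... | yes _ | no _  = refl
  ... | no _  | yes _ = refl
  ... | no _  | no _  = refl
  count-⊎-dec (suc n) Q? R? disj =
    trans (cong₂ _+_ (count-⊎-dec n _ _ (disj ∘ (outside ∷_))) (count-⊎-dec n _ _ (disj ∘ (inside ∷_))))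
          (interchange (countSub n (Q? ∘ (outside ∷_))) (countSub n (R? ∘ (outside ∷_)))
                       (countSub n (Q? ∘ (inside ∷_))) (countSub n (R? ∘ (inside ∷_))))

countSub-∃ : ∀ n {m} (S : Subset m) {A : Fin m → Subset n → Set} (A? : ∀ u → Decidable (A u))
             {P : Subset n → Set} (P? : Decidable P) →
             (∀ σ → P σ ⇔ ∃ λ u → u ∈ S × A u σ) → (∀ {u u′} σ → A u σ → A u′ σ → u ≡ u′) →
             countSub n P? ≡ sumOver S (λ u → countSub n (A? u))
countSub-∃ n []            A? P? P⇔∃ A-disj = countSub-∅ n P? (λ σ p → case proj₁ (proj₂ (to (P⇔∃ σ) p)) of λ ())
countSub-∃ n (outside ∷ S) {A} A? P? P⇔∃ A-disj =
  countSub-∃ n S (A? ∘ suc) P? (λ σ → mk⇔ (shift ∘ to (P⇔∃ σ)) (from (P⇔∃ σ) ∘ unshift))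
             (λ σ a a′ → Finₚ.suc-injective (A-disj σ a a′))
  where
  shift : ∀ {σ} → ∃ (λ u → u ∈ outside ∷ S × A u σ) → ∃ (λ u → u ∈ S × A (suc u) σ)
  shift (suc u , there u∈S , a) = u , u∈S , a
  unshift : ∀ {σ} → ∃ (λ u → u ∈ S × A (suc u) σ) → ∃ (λ u → u ∈ outside ∷ S × A u σ)
  unshift (u , u∈S , a) = suc u , there u∈S , a
countSub-∃ n (inside ∷ S) {A} A? P? P⇔∃ A-disj =
  trans (countSub-⊎ n P? (A? zero) R? (λ σ → mk⇔ (split ∘ to (P⇔∃ σ)) (from (P⇔∃ σ) ∘ unsplit)) disj)
        (cong (_+_ (countSub n (A? zero)))
              (countSub-∃ n S (A? ∘ suc) R? (λ σ → mk⇔ id id) (λ σ a a′ → Finₚ.suc-injective (A-disj σ a a′))))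
  where
  R : Subset _ → Set
  R σ = ∃ λ u → u ∈ S × A (suc u) σ
  R? : Decidable R
  R? σ = any? (λ u → (u ∈? S) ×-dec A? (suc u) σ)
  split : ∀ {σ} → ∃ (λ u → u ∈ inside ∷ S × A u σ) → A zero σ ⊎ R σ
  split (zero  , _          , a) = inj₁ a
  split (suc u , there u∈S , a) = inj₂ (u , u∈S , a)
  unsplit : ∀ {σ} → A zero σ ⊎ R σ → ∃ (λ u → u ∈ inside ∷ S × A u σ)
  unsplit (inj₁ a)             = zero , here , a
  unsplit (inj₂ (u , u∈S , a)) = suc u , there u∈S , a
  disj : ∀ σ → A zero σ → ¬ R σ
  disj σ a (u , _ , a') with () ← A-disj σ a a'

countSub-insert : ∀ n (u : Fin n) {P Q : Subset n → Set} (P? : Decidable P) (Q? : Decidable Q) →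
                  (∀ σ → P σ ⇔ (u ∈ σ × Q (remove u σ))) → (∀ τ → Q τ → u ∉ τ) →
                  countSub n P? ≡ countSub n Q?
countSub-insert (suc n) zero P? Q? P⇔ Q⇒u∉ =
  begin
    countSub n (P? ∘ (outside ∷_)) + countSub n (P? ∘ (inside ∷_))
  ≡⟨ cong₂ _+_ (countSub-∅ n _ (λ σ p → case proj₁ (to (P⇔ (outside ∷ σ)) p) of λ ()))
               (countSub-cong n _ _ (λ σ → mk⇔ (proj₂ ∘ to (P⇔ (inside ∷ σ))) (from (P⇔ (inside ∷ σ)) ∘ (here ,_)))) ⟩
    0 + countSub n (Q? ∘ (outside ∷_))
  ≡⟨ +-comm 0 _ ⟩
    countSub n (Q? ∘ (outside ∷_)) + 0
  ≡⟨ cong (_+_ (countSub n (Q? ∘ (outside ∷_)))) (sym (countSub-∅ n _ (λ σ q → Q⇒u∉ (inside ∷ σ) q here))) ⟩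
    countSub n (Q? ∘ (outside ∷_)) + countSub n (Q? ∘ (inside ∷_))
  ∎
  where open ≡-Reasoning
countSub-insert (suc n) (suc u) {P} {Q} P? Q? P⇔ Q⇒u∉ =
  cong₂ _+_ (countSub-insert n u _ _ (shift outside) (λ τ q u∈ → Q⇒u∉ (outside ∷ τ) q (there u∈)))
            (countSub-insert n u _ _ (shift inside)  (λ τ q u∈ → Q⇒u∉ (inside ∷ τ) q (there u∈)))
  where
  shift : ∀ b σ → P (b ∷ σ) ⇔ (u ∈ σ × Q (b ∷ remove u σ))
  shift b σ = mk⇔ (λ p → let (u∈ , q) = to (P⇔ (b ∷ σ)) p in drop-there u∈ , q)
                  (λ (u∈ , q) → from (P⇔ (b ∷ σ)) (there u∈ , q))

indicator : ∀ {p} {P : Set p} → Dec P → ℕ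
indicator (yes _) = 1
indicator (no _)  = 0

indicator-⇔ : ∀ {p q} {P : Set p} {Q : Set q} (P? : Dec P) (Q? : Dec Q) → P ⇔ Q → indicator P? ≡ indicator Q?
indicator-⇔ (yes _) (yes _) _   = refl
indicator-⇔ (no _)  (no _)  _   = refl
indicator-⇔ (yes p) (no ¬q) P⇔Q = ⊥-elim (¬q (to P⇔Q p))
indicator-⇔ (no ¬p) (yes q) P⇔Q = ⊥-elim (¬p (from P⇔Q q))

indicator-¬ : ∀ {p} {P : Set p} (P? : Dec P) → indicator (¬? P?) + indicator P? ≡ 1
indicator-¬ (yes _) = refl
indicator-¬ (no _)  = refl

sumOver-cong : ∀ (S : Subset m) {f g : Fin m → ℕ} → (∀ u → u ∈ S → f u ≡ g u) → sumOver S f ≡ sumOver S g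
sumOver-cong []            f≗g = refl
sumOver-cong (outside ∷ S) f≗g = sumOver-cong S (λ u → f≗g (suc u) ∘ there)
sumOver-cong (inside ∷ S)  f≗g = cong₂ _+_ (f≗g zero here) (sumOver-cong S (λ u → f≗g (suc u) ∘ there))

sumOver-+ : ∀ (S : Subset m) (f g : Fin m → ℕ) → sumOver S (λ u → f u + g u) ≡ sumOver S f + sumOver S g
sumOver-+ []            f g = refl
sumOver-+ (outside ∷ S) f g = sumOver-+ S (f ∘ suc) (g ∘ suc)
sumOver-+ (inside ∷ S)  f g =
  trans (cong (_+_ (f zero + g zero)) (sumOver-+ S (f ∘ suc) (g ∘ suc)))
        (interchange (f zero) (g zero) (sumOver S (f ∘ suc)) (sumOver S (g ∘ suc)))

sumOver-⊤ : ∀ (S : Subset m) (f : Fin m → ℕ) → (∀ u → u ∉ S → f u ≡ 0) → sumOver ⊤ f ≡ sumOver S f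
sumOver-⊤ []            f f=0 = refl
sumOver-⊤ (outside ∷ S) f f=0 =
  cong₂ _+_ (f=0 zero λ ()) (sumOver-⊤ S (f ∘ suc) (λ u u∉ → f=0 (suc u) (u∉ ∘ drop-there)))
sumOver-⊤ (inside ∷ S)  f f=0 =
  cong (_+_ (f zero)) (sumOver-⊤ S (f ∘ suc) (λ u u∉ → f=0 (suc u) (u∉ ∘ drop-there)))

∣S∣≡sumOver-1 : ∀ (S : Subset m) → ∣ S ∣ ≡ sumOver S (λ _ → 1)
∣S∣≡sumOver-1 []            = refl
∣S∣≡sumOver-1 (outside ∷ S) = ∣S∣≡sumOver-1 S
∣S∣≡sumOver-1 (inside ∷ S)  = cong suc (∣S∣≡sumOver-1 S)

countFin≡sumOver : ∀ {P : Fin m → Set} (P? : Decidable P) → countFin P? ≡ sumOver ⊤ (indicator ∘ P?)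
countFin≡sumOver {m} P? = length-filter-tabulate m (λ i → i)
  where
  length-filter-tabulate : ∀ m (g : Fin m → Fin _) → length (filter P? (tabulate g)) ≡ sumOver ⊤ (indicator ∘ P? ∘ g)
  length-filter-tabulate zero    g = refl
  length-filter-tabulate (suc m) g with P? (g zero)
  ... | yes _ = cong suc (length-filter-tabulate m (g ∘ suc))
  ... | no _  = length-filter-tabulate m (g ∘ suc)

indicator-yes : ∀ {p} {P : Set p} (P? : Dec P) → P → indicator P? ≡ 1
indicator-yes (yes _) _ = refl
indicator-yes (no ¬p) p = ⊥-elim (¬p p)

indicator-no : ∀ {p} {P : Set p} (P? : Dec P) → ¬ P → indicator P? ≡ 0
indicator-no (yes p) ¬p = ⊥-elim (¬p p)
indicator-no (no _)  _  = refl

+a≡+[a+b]-[+[k+b]-+k] : ∀ a b k → + a ≡ + (a + b) - (+ (k + b) - + k)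
+a≡+[a+b]-[+[k+b]-+k] a b k rewrite pos-+ a b | pos-+ k b = identity (+ a) (+ b) (+ k)
  where
  identity : ∀ (a b k : ℤ) → a ≡ (a ℤ.+ b) - ((k ℤ.+ b) - k)
  identity = solve-∀

module _ {n : ℕ} where

  Unmatched : Matching n → Subset n → Set
  Unmatched M σ = All (λ p → ¬ InPair σ p) M

  inPair? : (σ : Subset n) (p : Pair n) → Dec (InPair σ p)
  inPair? σ (α , β) = (σ ≟ˢ α) ⊎-dec (σ ≟ˢ β)

  unmatched? : (M : Matching n) → Decidable (Unmatched M)
  unmatched? M σ = All.all? (¬? ∘ inPair? σ) M

  ¬unmatched⇒pair : ∀ M {σ} → ¬ Unmatched M σ → ∃ λ p → p ∈ₗ M × InPair σ p
  ¬unmatched⇒pair M {σ} ¬unm with Any.any? (inPair? σ) M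
  ... | yes σ∈M = find σ∈M
  ... | no  σ∉M = ⊥-elim (¬unm (¬Any⇒All¬ M σ∉M))

  PairsDisjoint : Matching n → Set
  PairsDisjoint M = ∀ {p q} → p ∈ₗ M → q ∈ₗ M → Share p q → p ≡ q

  IndexedPairsDisjoint : Matching n → Set
  IndexedPairsDisjoint M = ∀ i j → Share (lookup M i) (lookup M j) → i ≡ j

  indexed⇒pairsDisjoint : ∀ M → IndexedPairsDisjoint M → PairsDisjoint M
  indexed⇒pairsDisjoint M disj {p} {q} p∈ q∈ share = begin
    p                        ≡⟨ lookup-index p∈ ⟩
    lookup M (index p∈)      ≡⟨ cong (lookup M) (disj (index p∈) (index q∈) share′) ⟩
    lookup M (index q∈)      ≡⟨ sym (lookup-index q∈) ⟩
    q                        ∎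
    where
    open ≡-Reasoning
    share′ : Share (lookup M (index p∈)) (lookup M (index q∈))
    share′ = subst₂ Share (lookup-index p∈) (lookup-index q∈) share


  pairsDisjoint⇒indexed : ∀ M → Unique M → PairsDisjoint M → IndexedPairsDisjoint M
  pairsDisjoint⇒indexed (p ∷ M) _          disj zero    zero    _     = refl
  pairsDisjoint⇒indexed (p ∷ M) (p∉M ∷ _)  disj zero    (suc j) share =
    ⊥-elim (All.lookup p∉M (∈-lookup j) (disj (Any.here refl) (Any.there (∈-lookup j)) share))
  pairsDisjoint⇒indexed (p ∷ M) (p∉M ∷ _)  disj (suc i) zero    share =
    ⊥-elim (All.lookup p∉M (∈-lookup i) (sym (disj (Any.there (∈-lookup i)) (Any.here refl) share)))
  pairsDisjoint⇒indexed (p ∷ M) (_    ∷ uM) disj (suc i) (suc j) share =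
    cong suc (pairsDisjoint⇒indexed M uM (λ p∈ q∈ → disj (Any.there p∈) (Any.there q∈)) i j share)

  share-sym : ∀ (p q : Pair n) → Share p q → Share q p
  share-sym (α , β) (γ , δ) (inj₁ (inj₁ refl)) = inj₁ (inj₁ refl)
  share-sym (α , β) (γ , δ) (inj₁ (inj₂ refl)) = inj₂ (inj₁ refl)
  share-sym (α , β) (γ , δ) (inj₂ (inj₁ refl)) = inj₁ (inj₂ refl)
  share-sym (α , β) (γ , δ) (inj₂ (inj₂ refl)) = inj₂ (inj₂ refl)

  InPair-∉ : ∀ {x : Fin n} {σ α β : Subset n} → x ∉ α × x ∉ β → InPair σ (α , β) → x ∉ σ
  InPair-∉ (x∉α , _)   (inj₁ refl) = x∉α
  InPair-∉ (_   , x∉β) (inj₂ refl) = x∉β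

  InPair-∈ : ∀ {x : Fin n} {σ α β : Subset n} → x ∈ α → x ∈ β → InPair σ (α , β) → x ∈ σ
  InPair-∈ x∈α _   (inj₁ refl) = x∈α
  InPair-∈ _   x∈β (inj₂ refl) = x∈β

  InPair-remove : ∀ {u : Fin n} {σ α β : Subset n} → InPair σ (α , β) → InPair (remove u σ) (remove u α , remove u β)
  InPair-remove (inj₁ refl) = inj₁ refl
  InPair-remove (inj₂ refl) = inj₂ refl

  InPair⇒Share : ∀ {σ : Subset n} {p q : Pair n} → InPair σ p → InPair σ q → Share p q
  InPair⇒Share (inj₁ refl) σ∈q = inj₁ σ∈q
  InPair⇒Share (inj₂ refl) σ∈q = inj₂ σ∈q

  ⁅x⁆≢⊥ : (x : Fin n) → ⁅ x ⁆ ≢ ⊥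
  ⁅x⁆≢⊥ x ⁅x⁆≡⊥ = ∉⊥ (subst (x ∈_) ⁅x⁆≡⊥ (x∈⁅x⁆ x))

  DownClosed : Complex n → Set
  DownClosed X = ∀ {σ τ} → σ ⊆ τ → Face X τ → Face X σ

  -- Matching ⊥ with ⁅ x ⁆ creates no cycle: no edge leaves ⁅ x ⁆ afterwards, since its only face ⊥ is now its partner.
  module _ (X : Complex n) {M : Matching n} {x : Fin n}
           (M-acyclic : IsAcyclicMatching X M) (⊥∈X : Face X ⊥) (x∈X : IsVertex X x)
           (⊥-unmatched : Unmatched M ⊥) (x-unmatched : Unmatched M ⁅ x ⁆) where

    private
      M⁺ : Matching n
      M⁺ = (⊥ , ⁅ x ⁆) ∷ M

      no-step-from-x : ∀ σ → ¬ Step X M⁺ ⁅ x ⁆ σ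
      no-step-from-x σ (inj₁ ((_ , _ , _ , ∣x∣≡1+∣σ∣) , ∉M⁺)) =
        ∉M⁺ (Any.here (cong (_, ⁅ x ⁆) (∣p∣≡0⇒p≡⊥ σ (suc-injective (trans (sym ∣x∣≡1+∣σ∣) (∣⁅x⁆∣≡1 x))))))
      no-step-from-x σ (inj₂ (Any.here eq))   = ⁅x⁆≢⊥ x (cong proj₁ eq)
      no-step-from-x σ (inj₂ (Any.there ∈M)) = All.lookup x-unmatched ∈M (inj₁ refl)

      no-path-from-x : ∀ {σ} → ¬ TransClosure (Step X M⁺) ⁅ x ⁆ σ
      no-path-from-x [ s ]   = no-step-from-x _ s
      no-path-from-x (s ∷ _) = no-step-from-x _ s

      step⁺ : ∀ {σ τ} → Step X M⁺ σ τ → Step X M σ τ ⊎ τ ≡ ⁅ x ⁆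
      step⁺ (inj₁ (edge , ∉M⁺))  = inj₁ (inj₁ (edge , ∉M⁺ ∘ Any.there))
      step⁺ (inj₂ (Any.here refl))  = inj₂ refl
      step⁺ (inj₂ (Any.there ∈M))   = inj₁ (inj₂ ∈M)

      path⁺ : ∀ {σ τ} → TransClosure (Step X M⁺) σ τ → TransClosure (Step X M) σ τ ⊎ τ ≡ ⁅ x ⁆
      path⁺ [ s ] with step⁺ s
      ... | inj₁ s′   = inj₁ [ s′ ]
      ... | inj₂ refl = inj₂ refl
      path⁺ (s ∷ rest) with path⁺ rest | step⁺ s
      ... | inj₂ refl | _         = inj₂ refl
      ... | inj₁ p    | inj₁ s′   = inj₁ (s′ ∷ p)
      ... | inj₁ _    | inj₂ refl = ⊥-elim (no-path-from-x rest)

    ∷⊥-acyclic : IsAcyclicMatching X ((⊥ , ⁅ x ⁆) ∷ M)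
    ∷⊥-acyclic = ((⊥∈X , x∈X , ⊥⊆ , ∣x∣≡1+∣⊥∣) ∷ proj₁ M-acyclic) , disjoint , acyclic
      where
      ∣x∣≡1+∣⊥∣ : ∣ ⁅ x ⁆ ∣ ≡ suc ∣ ⊥ {n} ∣
      ∣x∣≡1+∣⊥∣ = trans (∣⁅x⁆∣≡1 x) (cong suc (sym (∣⊥∣≡0 n)))
      new-disjoint : ∀ {q} → q ∈ₗ M → ¬ Share (⊥ , ⁅ x ⁆) q
      new-disjoint ∈M (inj₁ ⊥∈q) = All.lookup ⊥-unmatched ∈M ⊥∈q
      new-disjoint ∈M (inj₂ x∈q) = All.lookup x-unmatched ∈M x∈q
      disjoint : IndexedPairsDisjoint M⁺
      disjoint zero    zero    _     = refl
      disjoint zero    (suc j) share = ⊥-elim (new-disjoint (∈-lookup j) share)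
      disjoint (suc i) zero    share = ⊥-elim (new-disjoint (∈-lookup i) (share-sym _ _ share))
      disjoint (suc i) (suc j) share = cong suc (proj₁ (proj₂ M-acyclic) i j share)
      acyclic : ∀ σ → ¬ TransClosure (Step X M⁺) σ σ
      acyclic σ cycle with path⁺ cycle
      ... | inj₁ cycle′ = proj₂ (proj₂ M-acyclic) σ cycle′
      ... | inj₂ refl   = no-path-from-x cycle

  module _ (X : Complex n) (X-closed : DownClosed X) {M : Matching n}
           (M-acyclic : IsAcyclicMatching X M) (⊥-unmatched : Unmatched M ⊥) where

    private
      Vertex : Set
      Vertex = Σ (Fin n) (IsVertex X)

      Path : Fin n → Fin n → Set
      Path y z = TransClosure (Step X M) ⁅ y ⁆ ⁅ z ⁆

    -- As ⊥ is unmatched, the partner of a matched vertex y is an edge β ⊇ ⁅ y ⁆; its other vertex z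
    -- gives the path ⁅ y ⁆ → β → ⁅ z ⁆.
    matched-vertex-step : ∀ {y} → IsVertex X y → ¬ Unmatched M ⁅ y ⁆ → ∃ λ z → IsVertex X z × Path y z
    matched-vertex-step {y} y∈X y-matched with ¬unmatched⇒pair M y-matched
    ... | (α , β) , ∈M , inj₂ refl with All.lookup (proj₁ M-acyclic) ∈M
    ...   | _ , _ , _ , ∣y∣≡1+∣α∣ =
      ⊥-elim (All.lookup ⊥-unmatched ∈M (inj₁ (sym (∣p∣≡0⇒p≡⊥ α (suc-injective (trans (sym ∣y∣≡1+∣α∣) (∣⁅x⁆∣≡1 y)))))))
    matched-vertex-step {y} y∈X y-matched | (α , β) , ∈M , inj₁ refl with All.lookup (proj₁ M-acyclic) ∈M
    ...   | _ , β∈X , y⊆β , ∣β∣≡1+∣y∣ with another-element y β (y⊆β (x∈⁅x⁆ y)) (trans ∣β∣≡1+∣y∣ (cong suc (∣⁅x⁆∣≡1 y)))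
    ...     | z , z∈β , z≢y = z , z∈X , inj₂ ∈M ∷ [ inj₁ ((z∈X , β∈X , z⊆β , ∣β∣≡1+∣z∣) , z-unmatched) ]
      where
      z⊆β : ⁅ z ⁆ ⊆ β
      z⊆β w∈ = subst (_∈ β) (sym (x∈⁅y⁆⇒x≡y z w∈)) z∈β
      z∈X : IsVertex X z
      z∈X = X-closed z⊆β β∈X
      ∣β∣≡1+∣z∣ : ∣ β ∣ ≡ suc ∣ ⁅ z ⁆ ∣
      ∣β∣≡1+∣z∣ = trans ∣β∣≡1+∣y∣ (cong suc (trans (∣⁅x⁆∣≡1 y) (sym (∣⁅x⁆∣≡1 z))))
      z-unmatched : ¬ (⁅ z ⁆ , β) ∈ₗ M
      z-unmatched ∈M′ with indexed⇒pairsDisjoint M (proj₁ (proj₂ M-acyclic)) ∈M′ ∈M (inj₂ (inj₂ refl))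
      ... | eq = z≢y (x∈⁅y⁆⇒x≡y y (subst (z ∈_) (cong proj₁ eq) (x∈⁅x⁆ z)))

    module _ (all-matched : ∀ y → IsVertex X y → ¬ Unmatched M ⁅ y ⁆) where

      private
        next : (w : Vertex) → Σ Vertex λ w′ → Path (proj₁ w) (proj₁ w′)
        next (y , y∈X) with matched-vertex-step y∈X (all-matched y y∈X)
        ... | z , z∈X , path = (z , z∈X) , path

        walk : Vertex → ℕ → Vertex
        walk w zero    = w
        walk w (suc k) = proj₁ (next (walk w k))

        walk-path : ∀ w i j → i < j → Path (proj₁ (walk w i)) (proj₁ (walk w j))
        walk-path w i (suc j) i<1+j with m<1+n⇒m<n∨m≡n i<1+j
        ... | inj₁ i<j  = walk-path w i j i<j ++⁺ proj₂ (next (walk w j))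
        ... | inj₂ refl = proj₂ (next (walk w i))

      all-vertices-matched⇒no-vertex : ∀ y → ¬ IsVertex X y
      all-vertices-matched⇒no-vertex y y∈X with pigeonhole (n<1+n n) (λ i → proj₁ (walk (y , y∈X) (toℕ i)))
      ... | i , j , i<j , same =
        proj₂ (proj₂ M-acyclic) _ (subst (Path _) (sym same) (walk-path (y , y∈X) (toℕ i) (toℕ j) i<j))

-- Completing a matching at the empty simplex

module Completion {n : ℕ} (X : Complex n) (M : Matching n) where

  complete : Matching n
  complete with unmatched? M ⊥
  ... | no _ = M
  ... | yes _ with any? (λ x → face? X ⁅ x ⁆ ×-dec unmatched? M ⁅ x ⁆)
  ...   | yes (x , _) = (⊥ , ⁅ x ⁆) ∷ M
  ...   | no _        = M

  data Case : Matching n → Set where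
    ⊥-matched    : ¬ Unmatched M ⊥ → Case M
    ⊥-paired     : ∀ x → Unmatched M ⊥ → IsVertex X x → Unmatched M ⁅ x ⁆ → Case ((⊥ , ⁅ x ⁆) ∷ M)
    ⊥-unpairable : Unmatched M ⊥ → (∀ x → IsVertex X x → ¬ Unmatched M ⁅ x ⁆) → Case M

  case : Case complete
  case with unmatched? M ⊥
  ... | no ⊥-m = ⊥-matched ⊥-m
  ... | yes ⊥-u with any? (λ x → face? X ⁅ x ⁆ ×-dec unmatched? M ⁅ x ⁆)
  ...   | yes (x , x∈X , x-u) = ⊥-paired x ⊥-u x∈X x-u
  ...   | no ∄x               = ⊥-unpairable ⊥-u (λ x x∈X x-u → ∄x (x , x∈X , x-u))

  HasVertex : Set
  HasVertex = ∃ (IsVertex X)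

  hasVertex? : Dec HasVertex
  hasVertex? = any? (λ x → face? X ⁅ x ⁆)

  UnmatchedFace : Matching n → ℕ → Subset n → Set
  UnmatchedFace M′ t τ = ∣ τ ∣ ≡ t × Face X τ × Unmatched M′ τ

  unmatchedFace? : ∀ M′ t → Decidable (UnmatchedFace M′ t)
  unmatchedFace? M′ t τ = (∣ τ ∣ ≟ℕ t) ×-dec face? X τ ×-dec unmatched? M′ τ

  module Properties (X-closed : DownClosed X) (⊥∈X : Face X ⊥) (M-acyclic : IsAcyclicMatching X M) where

    private
      codim : ∀ {α β} → (α , β) ∈ₗ M → CodimOne X α β
      codim = All.lookup (proj₁ M-acyclic)

      M-disjoint : PairsDisjoint M
      M-disjoint = indexed⇒pairsDisjoint M (proj₁ (proj₂ M-acyclic))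

      nonempty-face⇒vertex : ∀ {σ} → Face X σ → σ ≢ ⊥ → HasVertex
      nonempty-face⇒vertex {σ} σ∈X σ≢⊥ with nonempty σ σ≢⊥
      ... | x , x∈σ = x , X-closed (λ y∈ → subst (_∈ σ) (sym (x∈⁅y⁆⇒x≡y _ y∈)) x∈σ) σ∈X

      ∣σ∣≡1+k⇒σ≢⊥ : ∀ {σ : Subset n} {k} → ∣ σ ∣ ≡ suc k → σ ≢ ⊥
      ∣σ∣≡1+k⇒σ≢⊥ ∣σ∣≡1+k refl = 0≢1+n (trans (sym (∣⊥∣≡0 n)) ∣σ∣≡1+k)

      partner-of-⊥ : ∀ {β} → (⊥ , β) ∈ₗ M → ∣ β ∣ ≡ 1 × Face X β
      partner-of-⊥ ∈M with codim ∈M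
      ... | _ , β∈X , _ , ∣β∣≡1+∣⊥∣ = trans ∣β∣≡1+∣⊥∣ (cong suc (∣⊥∣≡0 n)) , β∈X

      ⊥-matched⇒partner : ¬ Unmatched M ⊥ → ∃ λ β → (⊥ , β) ∈ₗ M
      ⊥-matched⇒partner ⊥-m with ¬unmatched⇒pair M ⊥-m
      ... | (α , β) , ∈M , inj₁ refl = β , ∈M
      ... | (α , β) , ∈M , inj₂ refl with codim ∈M
      ...   | _ , _ , _ , ∣⊥∣≡1+∣α∣ = ⊥-elim (0≢1+n (trans (sym (∣⊥∣≡0 n)) ∣⊥∣≡1+∣α∣))

      ⊥-matched⇒vertex : ¬ Unmatched M ⊥ → HasVertex
      ⊥-matched⇒vertex ⊥-m with ⊥-matched⇒partner ⊥-m
      ... | β , ∈M with partner-of-⊥ ∈M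
      ...   | ∣β∣≡1 , β∈X = nonempty-face⇒vertex β∈X (∣σ∣≡1+k⇒σ≢⊥ ∣β∣≡1)

      unpairable⇒no-vertex : Unmatched M ⊥ → (∀ x → IsVertex X x → ¬ Unmatched M ⁅ x ⁆) → ¬ HasVertex
      unpairable⇒no-vertex ⊥-u all-m (x , x∈X) = all-vertices-matched⇒no-vertex X X-closed M-acyclic ⊥-u all-m x x∈X

    case-acyclic : ∀ {M′} → Case M′ → IsAcyclicMatching X M′
    case-acyclic (⊥-matched _)            = M-acyclic
    case-acyclic (⊥-paired x ⊥-u x∈X x-u) = ∷⊥-acyclic X M-acyclic ⊥∈X x∈X ⊥-u x-u
    case-acyclic (⊥-unpairable _ _)       = M-acyclic

    complete-acyclic : IsAcyclicMatching X complete
    complete-acyclic = case-acyclic case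

    case-unmatched-⊥ : ∀ {M′} → Case M′ → Unmatched M′ ⊥ ⇔ (¬ HasVertex)
    case-unmatched-⊥ (⊥-matched ⊥-m) = mk⇔ (⊥-elim ∘ ⊥-m) (λ ∄v → ⊥-elim (∄v (⊥-matched⇒vertex ⊥-m)))
    case-unmatched-⊥ (⊥-paired x _ x∈X _) =
      mk⇔ (λ ⊥-u → ⊥-elim (All.head ⊥-u (inj₁ refl))) (λ ∄x → ⊥-elim (∄x (x , x∈X)))
    case-unmatched-⊥ (⊥-unpairable ⊥-u all-m) = mk⇔ (λ _ → unpairable⇒no-vertex ⊥-u all-m) (λ _ → ⊥-u)

    case-unmatched-≥2 : ∀ {M′} → Case M′ → ∀ {σ} → 2 ≤ ∣ σ ∣ → Unmatched M′ σ ⇔ Unmatched M σ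
    case-unmatched-≥2 (⊥-matched _)        _ = mk⇔ id id
    case-unmatched-≥2 (⊥-unpairable _ _)   _ = mk⇔ id id
    case-unmatched-≥2 (⊥-paired x _ _ _) {σ} 2≤∣σ∣ = mk⇔ All.tail (not-in-new ∷_)
      where
      not-in-new : ¬ InPair σ (⊥ , ⁅ x ⁆)
      not-in-new (inj₁ refl) with () ← subst (2 ≤_) (∣⊥∣≡0 n) 2≤∣σ∣
      not-in-new (inj₂ refl) with s≤s () ← subst (2 ≤_) (∣⁅x⁆∣≡1 x) 2≤∣σ∣

    count-unmatched-⊥ : ∀ M′ → countSub n (unmatchedFace? M′ 0) ≡ indicator (unmatched? M′ ⊥)
    count-unmatched-⊥ M′ with unmatched? M′ ⊥
    ... | yes ⊥-u = trans (countSub-cong n _ (_≟ˢ ⊥) (λ σ → mk⇔ (λ (∣σ∣≡0 , _) → ∣p∣≡0⇒p≡⊥ σ ∣σ∣≡0)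
                                                               (λ { refl → ∣⊥∣≡0 n , ⊥∈X , ⊥-u })))
                          (countSub-≡ n ⊥)
    ... | no ⊥-m  = countSub-∅ n _ (λ σ (∣σ∣≡0 , _ , σ-u) → ⊥-m (subst (Unmatched M′) (∣p∣≡0⇒p≡⊥ σ ∣σ∣≡0) σ-u))

    unmatched-0 : countSub n (unmatchedFace? complete 0) ≡ indicator (¬? hasVertex?)
    unmatched-0 = trans (count-unmatched-⊥ complete) (indicator-⇔ _ _ (case-unmatched-⊥ case))

    unmatched-≥2 : ∀ t → countSub n (unmatchedFace? complete (suc (suc t))) ≡ f X M (suc t)
    unmatched-≥2 t = countSub-cong n _ _ (λ σ → mk⇔ (forth σ) (back σ))
      where
      2≤ : ∀ σ → ∣ σ ∣ ≡ suc (suc t) → 2 ≤ ∣ σ ∣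
      2≤ σ ∣σ∣≡2+t = subst (2 ≤_) (sym ∣σ∣≡2+t) (s≤s (s≤s z≤n))
      forth : ∀ σ → UnmatchedFace complete (suc (suc t)) σ → Critical X M σ × ∣ σ ∣ ≡ suc (suc t)
      forth σ (∣σ∣≡2+t , σ∈X , σ-u) =
        (∣σ∣≡1+k⇒σ≢⊥ ∣σ∣≡2+t , σ∈X , inj₁ (to (case-unmatched-≥2 case (2≤ σ ∣σ∣≡2+t)) σ-u)) , ∣σ∣≡2+t
      back : ∀ σ → Critical X M σ × ∣ σ ∣ ≡ suc (suc t) → UnmatchedFace complete (suc (suc t)) σ
      back σ ((_ , σ∈X , inj₁ σ-u) , ∣σ∣≡2+t) = ∣σ∣≡2+t , σ∈X , from (case-unmatched-≥2 case (2≤ σ ∣σ∣≡2+t)) σ-u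
      back σ ((_ , _ , inj₂ ∈M) , ∣σ∣≡2+t) with () ← suc-injective (trans (sym ∣σ∣≡2+t) (proj₁ (partner-of-⊥ ∈M)))

    private
      CriticalVertex : Subset n → Set
      CriticalVertex σ = Critical X M σ × ∣ σ ∣ ≡ 1

      -- When ⊥ is matched in M′, its partner is the one critical vertex of M that is not unmatched in M′.
      count-with-partner : ∀ {M′} ρ → HasVertex → ¬ UnmatchedFace M′ 1 ρ →
                           (∀ σ → CriticalVertex σ ⇔ (UnmatchedFace M′ 1 σ ⊎ σ ≡ ρ)) →
                           countSub n (unmatchedFace? M′ 1) + indicator hasVertex? ≡ f X M 0
      count-with-partner {M′} ρ has-vertex ρ-matched crit⇔ = sym (begin
        f X M 0                   ≡⟨ countSub-⊎ n _ _ (_≟ˢ ρ) crit⇔ (λ { σ σ-u refl → ρ-matched σ-u }) ⟩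
        c + countSub n (_≟ˢ ρ)    ≡⟨ cong (_+_ c) (countSub-≡ n ρ) ⟩
        c + 1                     ≡⟨ cong (_+_ c) (sym (indicator-yes hasVertex? has-vertex)) ⟩
        c + indicator hasVertex?  ∎)
        where
        open ≡-Reasoning
        c : ℕ
        c = countSub n (unmatchedFace? M′ 1)

    case-unmatched-1 : ∀ {M′} → Case M′ → countSub n (unmatchedFace? M′ 1) + indicator hasVertex? ≡ f X M 0
    case-unmatched-1 (⊥-matched ⊥-m) with ⊥-matched⇒partner ⊥-m
    ... | β , ∈M with partner-of-⊥ ∈M
    ...   | ∣β∣≡1 , β∈X = count-with-partner β (⊥-matched⇒vertex ⊥-m) (λ (_ , _ , β-u) → All.lookup β-u ∈M (inj₂ refl))
                            (λ σ → mk⇔ forth back)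
      where
      forth : ∀ {σ} → CriticalVertex σ → UnmatchedFace M 1 σ ⊎ σ ≡ β
      forth ((_ , σ∈X , inj₁ σ-u) , ∣σ∣≡1) = inj₁ (∣σ∣≡1 , σ∈X , σ-u)
      forth ((_ , _ , inj₂ ∈M′) , _) = inj₂ (cong proj₂ (M-disjoint ∈M′ ∈M (inj₁ (inj₁ refl))))
      back : ∀ {σ} → UnmatchedFace M 1 σ ⊎ σ ≡ β → CriticalVertex σ
      back (inj₁ (∣σ∣≡1 , σ∈X , σ-u)) = (∣σ∣≡1+k⇒σ≢⊥ ∣σ∣≡1 , σ∈X , inj₁ σ-u) , ∣σ∣≡1
      back (inj₂ refl) = (∣σ∣≡1+k⇒σ≢⊥ ∣β∣≡1 , β∈X , inj₂ ∈M) , ∣β∣≡1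
    case-unmatched-1 (⊥-paired x ⊥-u x∈X x-u) =
      count-with-partner ⁅ x ⁆ (x , x∈X) (λ (_ , _ , x-u′) → All.head x-u′ (inj₂ refl)) (λ σ → mk⇔ forth back)
      where
      forth : ∀ {σ} → CriticalVertex σ → UnmatchedFace ((⊥ , ⁅ x ⁆) ∷ M) 1 σ ⊎ σ ≡ ⁅ x ⁆
      forth {σ} ((σ≢⊥ , σ∈X , inj₁ σ-u) , ∣σ∣≡1) with σ ≟ˢ ⁅ x ⁆
      ... | yes σ≡x = inj₂ σ≡x
      ... | no  σ≢x = inj₁ (∣σ∣≡1 , σ∈X , Data.Sum.[ σ≢⊥ , σ≢x ] ∷ σ-u)
      forth ((_ , _ , inj₂ ∈M) , _) = ⊥-elim (All.lookup ⊥-u ∈M (inj₁ refl))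
      back : ∀ {σ} → UnmatchedFace ((⊥ , ⁅ x ⁆) ∷ M) 1 σ ⊎ σ ≡ ⁅ x ⁆ → CriticalVertex σ
      back (inj₁ (∣σ∣≡1 , σ∈X , σ-u)) = (∣σ∣≡1+k⇒σ≢⊥ ∣σ∣≡1 , σ∈X , inj₁ (All.tail σ-u)) , ∣σ∣≡1
      back (inj₂ refl) = (⁅x⁆≢⊥ x , x∈X , inj₁ x-u) , ∣⁅x⁆∣≡1 x
    case-unmatched-1 (⊥-unpairable ⊥-u all-m) = begin
      countSub n (unmatchedFace? M 1) + indicator hasVertex?
        ≡⟨ cong₂ _+_ (countSub-∅ n _ (λ σ (∣σ∣≡1 , σ∈X , _) → no-vertex (nonempty-face⇒vertex σ∈X (∣σ∣≡1+k⇒σ≢⊥ ∣σ∣≡1))))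
                     (indicator-no hasVertex? no-vertex) ⟩
      0
        ≡⟨ sym (countSub-∅ n _ (λ σ ((σ≢⊥ , σ∈X , _) , _) → no-vertex (nonempty-face⇒vertex σ∈X σ≢⊥))) ⟩
      f X M 0
        ∎
      where
      open ≡-Reasoning
      no-vertex : ¬ HasVertex
      no-vertex = unpairable⇒no-vertex ⊥-u all-m

    unmatched-1 : countSub n (unmatchedFace? complete 1) + indicator hasVertex? ≡ f X M 0
    unmatched-1 = case-unmatched-1 case

module GraphProperties {n : ℕ} (G : Graph n) where

  ¬Adj⇒nonadjacent : ∀ {a b} → ¬ Adj G a b → adj G a b ≡ false
  ¬Adj⇒nonadjacent = ¬-not

  Adj⇒≢ : ∀ {a b} → Adj G a b → a ≢ b
  Adj⇒≢ {a} a~b refl with () ← trans (sym a~b) (irrefl G a)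

  ∈N⁺ : ∀ {v u} → Adj G v u → u ∈ N G v
  ∈N⁺ {v} {u} v~u = lookup⇒[]= u (N G v) (trans (lookup∘tabulate (adj G v) u) v~u)

  ∈N⁻ : ∀ {v u} → u ∈ N G v → Adj G v u
  ∈N⁻ {v} {u} u∈ = trans (sym (lookup∘tabulate (adj G v) u)) ([]=⇒lookup u∈)

  N⊆N[] : ∀ {u w} → w ∈ N G u → w ∈ Nc G u
  N⊆N[] w∈N = x∈p∪q⁺ (inj₂ w∈N)

  u∈N[u] : ∀ u → u ∈ Nc G u
  u∈N[u] u = x∈p∪q⁺ (inj₁ (x∈⁅x⁆ u))

  ∈N[]⁺ : ∀ {u w} → Adj G u w → w ∈ Nc G u
  ∈N[]⁺ u~w = N⊆N[] (∈N⁺ u~w)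

  ∉N[]⁻ : ∀ {u w} → w ∉ Nc G u → w ≢ u × adj G u w ≡ false
  ∉N[]⁻ {u} w∉ = (λ { refl → w∉ (u∈N[u] u) }) , ¬Adj⇒nonadjacent (w∉ ∘ ∈N[]⁺)

  ∉N[]⁺ : ∀ {u w} → w ≢ u → adj G u w ≡ false → w ∉ Nc G u
  ∉N[]⁺ {u} {w} w≢u u≁w w∈ with x∈p∪q⁻ ⁅ u ⁆ (N G u) w∈
  ... | inj₁ w∈⁅u⁆ = w≢u (x∈⁅y⁆⇒x≡y u w∈⁅u⁆)
  ... | inj₂ w∈N   with () ← trans (sym (∈N⁻ w∈N)) u≁w

  Ind-downClosed : ∀ U → DownClosed (Ind G U)
  Ind-downClosed U σ⊆τ (τ⊆∁U , τ-indep) = (τ⊆∁U ∘ σ⊆τ) , (λ a b a∈ b∈ → τ-indep a b (σ⊆τ a∈) (σ⊆τ b∈))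

  ⊥∈Ind : ∀ U → Face (Ind G U) ⊥
  ⊥∈Ind U = (⊥-elim ∘ ∉⊥) , (λ a _ a∈ → ⊥-elim (∉⊥ a∈))

  vertex∈Ind : ∀ U {x} → x ∉ U → IsVertex (Ind G U) x
  vertex∈Ind U {x} x∉U = (λ y∈ → x∉p⇒x∈∁p (subst (_∉ U) (sym (x∈⁅y⁆⇒x≡y x y∈)) x∉U))
                       , (λ a b a∈ b∈ → subst₂ (λ a b → adj G a b ≡ false)
                                                (sym (x∈⁅y⁆⇒x≡y x a∈)) (sym (x∈⁅y⁆⇒x≡y x b∈)) (irrefl G x))

  Ind-avoids : ∀ {U σ x} → Face (Ind G U) σ → x ∈ U → x ∉ σ
  Ind-avoids (σ⊆∁U , _) x∈U x∈σ = x∈∁p⇒x∉p (σ⊆∁U x∈σ) x∈U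

  insert-independent : ∀ {x σ} → Independent G σ → (∀ b → b ∈ σ → adj G x b ≡ false) → Independent G (insert x σ)
  insert-independent {x} {σ} σ-indep x≁σ a b a∈ b∈ with ∈insert⁻ x σ a∈ | ∈insert⁻ x σ b∈
  ... | inj₁ refl | inj₁ refl = irrefl G x
  ... | inj₁ refl | inj₂ b∈σ  = x≁σ b b∈σ
  ... | inj₂ a∈σ  | inj₁ refl = trans (symm G a x) (x≁σ a a∈σ)
  ... | inj₂ a∈σ  | inj₂ b∈σ  = σ-indep a b a∈σ b∈σ

  N[]⊂⊤⇒¬universal : ∀ {v} → Nc G v ⊂ ⊤ → ¬ Universal G v
  N[]⊂⊤⇒¬universal (_ , w , _ , w∉N[v]) v-universal with ∉N[]⁻ w∉N[v]
  ... | w≢v , v≁w with () ← trans (sym (v-universal w w≢v)) v≁w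

  universal⇒∈N : ∀ {v u} → ¬ Universal G v → Universal G u → u ∈ N G v
  universal⇒∈N {v} {u} v-not-universal u-universal with u ≟ᶠ v
  ... | yes refl = ⊥-elim (v-not-universal u-universal)
  ... | no  u≢v  = ∈N⁺ (trans (symm G v u) (u-universal v (u≢v ∘ sym)))

  universal⇔no-vertex : ∀ u → Universal G u ⇔ (¬ ∃ (IsVertex I[ G - N[ G , u ] ]))
  universal⇔no-vertex u = mk⇔ forth back
    where
    forth : Universal G u → ¬ ∃ (IsVertex I[ G - N[ G , u ] ])
    forth u-univ (x , x∈X) with ∉N[]⁻ (x∈∁p⇒x∉p (proj₁ x∈X (x∈⁅x⁆ x)))
    ... | x≢u , u≁x with () ← trans (sym (u-univ x x≢u)) u≁x
    back : ¬ ∃ (IsVertex I[ G - N[ G , u ] ]) → Universal G u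
    back no-vertex w w≢u with adj G u w in u~w
    ... | true  = refl
    ... | false = ⊥-elim (no-vertex (w , vertex∈Ind (Nc G u) (∉N[]⁺ w≢u u~w)))

-- The matching on I(G)

module Construction {n : ℕ} (G : Graph n) (v : Fin n) (N[v]-clique : IsClique G N[ G , v ])
                    (𝒱 : Fin n → Matching n)
                    (𝒱-acyclic : ∀ u → u ∈ N G v → IsAcyclicMatching I[ G - N[ G , u ] ] (𝒱 u)) where

  open GraphProperties G

  X : Fin n → Complex n
  X u = I[ G - N[ G , u ] ]

  𝒲 : Fin n → Matching n
  𝒲 u = Completion.complete (X u) (𝒱 u)

  module Completed (u : Fin n) (u∈N : u ∈ N G v) =
    Completion.Properties (X u) (𝒱 u) (Ind-downClosed _) (⊥∈Ind _) (𝒱-acyclic u u∈N)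

  𝒲-acyclic : ∀ u → u ∈ N G v → IsAcyclicMatching (X u) (𝒲 u)
  𝒲-acyclic = Completed.complete-acyclic

  𝒲-disjoint : ∀ u → u ∈ N G v → PairsDisjoint (𝒲 u)
  𝒲-disjoint u u∈N = indexed⇒pairsDisjoint (𝒲 u) (proj₁ (proj₂ (𝒲-acyclic u u∈N)))

  ∈N⇒≢v : ∀ {u} → u ∈ N G v → u ≢ v
  ∈N⇒≢v u∈N = Adj⇒≢ (∈N⁻ u∈N) ∘ sym

  N[v]⊆N[u] : ∀ {u} → u ∈ N G v → Nc G v ⊆ Nc G u
  N[v]⊆N[u] {u} u∈N {w} w∈N[v] with w ≟ᶠ u
  ... | yes refl = u∈N[u] u
  ... | no  w≢u  = ∈N[]⁺ (N[v]-clique u w (∈N[]⁺ (∈N⁻ u∈N)) w∈N[v] (w≢u ∘ sym))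

  X-avoids-N[v] : ∀ {u τ w} → u ∈ N G v → Face (X u) τ → w ∈ Nc G v → w ∉ τ
  X-avoids-N[v] u∈N τ∈X w∈N[v] = Ind-avoids τ∈X (N[v]⊆N[u] u∈N w∈N[v])

  insert-face : ∀ {u τ} → Face (X u) τ → Face (I G) (insert u τ)
  insert-face τ∈X =
    (λ _ → x∉p⇒x∈∁p ∉⊥) ,
    insert-independent (proj₂ τ∈X) (λ b b∈τ → proj₂ (∉N[]⁻ (λ b∈N[u] → Ind-avoids τ∈X b∈N[u] b∈τ)))

  remove-face : ∀ {u σ} → Face (I G) σ → u ∈ σ → Face (X u) (remove u σ)
  remove-face {u} {σ} (_ , σ-indep) u∈σ =
    (λ {w} w∈ → x∉p⇒x∈∁p (∉N[]⁺ (λ { refl → x∉remove u σ w∈ }) (σ-indep u w u∈σ (remove⊆p u σ w∈)))) ,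
    (λ a b a∈ b∈ → σ-indep a b (remove⊆p u σ a∈) (remove⊆p u σ b∈))

  𝒲-codim : ∀ {u α β} → u ∈ N G v → (α , β) ∈ₗ 𝒲 u → CodimOne (X u) α β
  𝒲-codim u∈N = All.lookup (proj₁ (𝒲-acyclic _ u∈N))

  MissesN : Subset n → Set
  MissesN σ = ∀ {w} → w ∈ N G v → w ∉ σ

  ConePair : Subset n → Subset n → Set
  ConePair α β = v ∉ α × β ≡ insert v α × Face (I G) β

  LiftedPair : Fin n → Subset n → Subset n → Set
  LiftedPair u α β = u ∈ N G v × u ∈ α × u ∈ β × (remove u α , remove u β) ∈ₗ 𝒲 u

  InV : Pair n → Set
  InV (α , β) = ConePair α β ⊎ ∃ λ u → LiftedPair u α β

  inV? : Decidable InV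
  inV? (α , β) =
    (¬? (v ∈? α) ×-dec (β ≟ˢ insert v α) ×-dec face? (I G) β) ⊎-dec
    any? (λ u → (u ∈? N G v) ×-dec (u ∈? α) ×-dec (u ∈? β) ×-dec
                ∈ₗ-dec (≡-dec× _≟ˢ_ _≟ˢ_) (remove u α , remove u β) (𝒲 u))

  V : Matching n
  V = filter inV? (cartesianProduct (allSubsets n) (allSubsets n))

  ∈V⁻ : ∀ {p} → p ∈ₗ V → InV p
  ∈V⁻ p∈V = proj₂ (∈-filter⁻ inV? {xs = cartesianProduct (allSubsets n) (allSubsets n)} p∈V)

  ∈V⁺ : ∀ {α β} → InV (α , β) → (α , β) ∈ₗ V
  ∈V⁺ {α} {β} = ∈-filter⁺ inV? (∈-cartesianProduct⁺ (∈-allSubsets α) (∈-allSubsets β))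

  V-unique : Unique V
  V-unique = Unique.filter⁺ inV? (Unique.cartesianProduct⁺ (allSubsets-unique n) (allSubsets-unique n))

  containing-v⇒misses-N : ∀ {σ} → Face (I G) σ → v ∈ σ → MissesN σ
  containing-v⇒misses-N (_ , σ-indep) v∈σ w∈N w∈σ with () ← trans (sym (∈N⁻ w∈N)) (σ-indep v _ v∈σ w∈σ)

  cone-misses-N : ∀ {α β w} → ConePair α β → w ∈ N G v → w ∉ α × w ∉ β
  cone-misses-N {α} (v∉α , refl , β∈I) w∈N = w∉β ∘ p⊆insert v α , w∉β
    where
    w∉β : _ ∉ insert v α
    w∉β = containing-v⇒misses-N β∈I (x∈insert v α) w∈N

  lifted-misses-N : ∀ {u α β w} → LiftedPair u α β → w ∈ N G v → w ≢ u → w ∉ α × w ∉ β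
  lifted-misses-N {u} {α} {β} (u∈N , _ , _ , ∈𝒲) w∈N w≢u with 𝒲-codim u∈N ∈𝒲
  ... | α′∈X , β′∈X , _ =
    (λ w∈α → X-avoids-N[v] u∈N α′∈X (N⊆N[] w∈N) (∈remove⁺ u α w≢u w∈α)) ,
    (λ w∈β → X-avoids-N[v] u∈N β′∈X (N⊆N[] w∈N) (∈remove⁺ u β w≢u w∈β))

  cone-base : ∀ {σ α β} → ConePair α β → InPair σ (α , β) → α ≡ remove v σ
  cone-base {σ} (v∉α , refl , _) (inj₁ refl) = sym (remove-∉ v σ v∉α)
  cone-base {σ} (v∉α , refl , _) (inj₂ refl) = sym (remove-insert v _ v∉α)

  InV-determined : ∀ {σ : Subset n} {p q : Pair n} → InV p → InV q → InPair σ p → InPair σ q → p ≡ q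
  InV-determined (inj₁ cone@(_ , refl , _)) (inj₁ cone′@(_ , refl , _)) σ∈p σ∈q =
    cong (λ α → α , insert v α) (trans (cone-base cone σ∈p) (sym (cone-base cone′ σ∈q)))
  InV-determined (inj₁ cone) (inj₂ (u , u∈N , u∈γ , u∈δ , _)) σ∈p σ∈q =
    ⊥-elim (InPair-∉ (cone-misses-N cone u∈N) σ∈p (InPair-∈ u∈γ u∈δ σ∈q))
  InV-determined (inj₂ (u , u∈N , u∈α , u∈β , _)) (inj₁ cone) σ∈p σ∈q =
    ⊥-elim (InPair-∉ (cone-misses-N cone u∈N) σ∈q (InPair-∈ u∈α u∈β σ∈p))
  InV-determined (inj₂ (u , lifted@(u∈N , u∈α , u∈β , ∈𝒲))) (inj₂ (u′ , u′∈N , u′∈γ , u′∈δ , ∈𝒲′)) σ∈p σ∈q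
    with u′ ≟ᶠ u
  ... | no u′≢u = ⊥-elim (InPair-∉ (lifted-misses-N lifted u′∈N u′≢u) σ∈p (InPair-∈ u′∈γ u′∈δ σ∈q))
  ... | yes refl with 𝒲-disjoint u u∈N ∈𝒲 ∈𝒲′ (InPair⇒Share (InPair-remove σ∈p) (InPair-remove σ∈q))
  ...   | same = cong₂ _,_ (remove-injective u u∈α u′∈γ (cong proj₁ same))
                          (remove-injective u u∈β u′∈δ (cong proj₂ same))

  V-disjoint : PairsDisjoint V
  V-disjoint p∈V q∈V (inj₁ α∈q) = InV-determined (∈V⁻ p∈V) (∈V⁻ q∈V) (inj₁ refl) α∈q
  V-disjoint p∈V q∈V (inj₂ β∈q) = InV-determined (∈V⁻ p∈V) (∈V⁻ q∈V) (inj₂ refl) β∈q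

  V-codim : ∀ {α β} → InV (α , β) → CodimOne (I G) α β
  V-codim {α} (inj₁ (v∉α , refl , β∈I)) = Ind-downClosed ⊥ (p⊆insert v α) β∈I , β∈I , p⊆insert v α , ∣insert∣ v α v∉α
  V-codim {α} {β} (inj₂ (u , u∈N , u∈α , u∈β , ∈𝒲)) with 𝒲-codim u∈N ∈𝒲
  ... | α′∈X , β′∈X , α′⊆β′ , ∣β′∣≡1+∣α′∣ =
    subst (Face (I G)) (insert-remove u α u∈α) (insert-face α′∈X) ,
    subst (Face (I G)) (insert-remove u β u∈β) (insert-face β′∈X) ,
    α⊆β ,
    trans (∣remove∣ u β u∈β) (cong suc (trans ∣β′∣≡1+∣α′∣ (sym (∣remove∣ u α u∈α))))
    where
    α⊆β : α ⊆ β
    α⊆β {w} w∈α with w ≟ᶠ u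
    ... | yes refl = u∈β
    ... | no  w≢u  = remove⊆p u β (α′⊆β′ (∈remove⁺ u α w≢u w∈α))

  step-through : ∀ {u x y} → u ∈ N G v → Step (I G) V x y → u ∈ y →
                 u ∈ x × Step (X u) (𝒲 u) (remove u x) (remove u y)
  step-through {u} {x} {y} u∈N (inj₁ ((y∈I , x∈I , y⊆x , ∣x∣≡1+∣y∣) , y,x∉V)) u∈y =
    u∈x , inj₁ ((remove-face y∈I u∈y , remove-face x∈I u∈x , remove-mono u y⊆x , ∣x-u∣≡1+∣y-u∣) ,
                λ ∈𝒲 → y,x∉V (∈V⁺ (inj₂ (u , u∈N , u∈y , u∈x , ∈𝒲))))
    where
    u∈x : u ∈ x
    u∈x = y⊆x u∈y
    ∣x-u∣≡1+∣y-u∣ : ∣ remove u x ∣ ≡ suc ∣ remove u y ∣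
    ∣x-u∣≡1+∣y-u∣ = suc-injective (trans (sym (∣remove∣ u x u∈x)) (trans ∣x∣≡1+∣y∣ (cong suc (∣remove∣ u y u∈y))))
  step-through {u} u∈N (inj₂ x,y∈V) u∈y with ∈V⁻ x,y∈V
  ... | inj₁ cone = ⊥-elim (proj₂ (cone-misses-N cone u∈N) u∈y)
  ... | inj₂ (u′ , lifted@(_ , u′∈x , _ , ∈𝒲)) with u ≟ᶠ u′
  ...   | yes refl = u′∈x , inj₂ ∈𝒲
  ...   | no  u≢u′ = ⊥-elim (proj₂ (lifted-misses-N lifted u∈N u≢u′) u∈y)

  path-through : ∀ {u x y} → u ∈ N G v → TransClosure (Step (I G) V) x y → u ∈ y →
                 u ∈ x × TransClosure (Step (X u) (𝒲 u)) (remove u x) (remove u y)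
  path-through u∈N [ s ] u∈y with step-through u∈N s u∈y
  ... | u∈x , s′ = u∈x , [ s′ ]
  path-through u∈N (s ∷ path) u∈y with path-through u∈N path u∈y
  ... | u∈z , path′ with step-through u∈N s u∈z
  ...   | u∈x , s′ = u∈x , s′ ∷ path′

  -- The Hasse edge from σ to σ ∖ {v} is reversed: (σ ∖ {v} , σ) is a cone pair of V.
  hasse-keeps-v : ∀ {x y} → CodimOne (I G) y x → ¬ (y , x) ∈ₗ V → v ∈ x → v ∈ y
  hasse-keeps-v {x} {y} (_ , x∈I , y⊆x , ∣x∣≡1+∣y∣) y,x∉V v∈x with v ∈? y
  ... | yes v∈y = v∈y
  ... | no  v∉y = ⊥-elim (y,x∉V (∈V⁺ (inj₁ (v∉y , x≡y+v , x∈I))))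
    where
    y≡x-v : y ≡ remove v x
    y≡x-v = ⊆-∣∣-antisym (λ {w} w∈y → ∈remove⁺ v x (λ { refl → v∉y w∈y }) (y⊆x w∈y))
                         (≤-reflexive (suc-injective (trans (sym (∣remove∣ v x v∈x)) ∣x∣≡1+∣y∣)))
    x≡y+v : x ≡ insert v y
    x≡y+v = trans (sym (insert-remove v x v∈x)) (cong (insert v) (sym y≡x-v))

  -- On simplices missing N(v) the weight drops by 2 along Hasse edges (which keep v) and by 1 along cone pairs.
  penalty : Subset n → ℕ
  penalty σ = indicator (¬? (v ∈? σ)) * 3

  weight : Subset n → ℕ
  weight σ = penalty σ + ∣ σ ∣ * 2

  weight-hasse : ∀ {x y} → (v ∈ y ⇔ v ∈ x) → ∣ x ∣ ≡ suc ∣ y ∣ → weight y < weight x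
  weight-hasse {x} {y} v∈y⇔v∈x ∣x∣≡1+∣y∣ = begin-strict
    penalty y + ∣ y ∣ * 2      <⟨ +-monoʳ-< (penalty y) (m<n⇒m<1+n (n<1+n _)) ⟩
    penalty y + suc ∣ y ∣ * 2  ≡⟨ cong₂ (λ p k → p + k * 2) same-penalty (sym ∣x∣≡1+∣y∣) ⟩
    penalty x + ∣ x ∣ * 2      ∎
    where
    open ≤-Reasoning
    same-penalty : penalty y ≡ penalty x
    same-penalty = cong (_* 3) (indicator-⇔ (¬? (v ∈? y)) (¬? (v ∈? x)) (mk⇔ (_∘ from v∈y⇔v∈x) (_∘ to v∈y⇔v∈x)))

  weight-cone : ∀ {x} → v ∉ x → weight (insert v x) < weight x
  weight-cone {x} v∉x = begin-strict
    penalty (insert v x) + ∣ insert v x ∣ * 2  ≡⟨ cong₂ (λ p k → p * 3 + k * 2) v-in (∣insert∣ v x v∉x) ⟩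
    2 + ∣ x ∣ * 2                             <⟨ n<1+n _ ⟩
    3 + ∣ x ∣ * 2                             ≡⟨ cong (λ p → p * 3 + ∣ x ∣ * 2) (sym v-out) ⟩
    penalty x + ∣ x ∣ * 2                     ∎
    where
    open ≤-Reasoning
    v-in : indicator (¬? (v ∈? insert v x)) ≡ 0
    v-in = indicator-no (¬? (v ∈? insert v x)) (λ v∉ → v∉ (x∈insert v x))
    v-out : indicator (¬? (v ∈? x)) ≡ 1
    v-out = indicator-yes (¬? (v ∈? x)) v∉x

  step-misses-N : ∀ {x y} → MissesN x → Step (I G) V x y → MissesN y × weight y < weight x
  step-misses-N x-misses (inj₁ (codim@(_ , _ , y⊆x , ∣x∣≡1+∣y∣) , y,x∉V)) =
    (λ w∈N → x-misses w∈N ∘ y⊆x) , weight-hasse (mk⇔ y⊆x (hasse-keeps-v codim y,x∉V)) ∣x∣≡1+∣y∣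
  step-misses-N x-misses (inj₂ x,y∈V) with ∈V⁻ x,y∈V
  ... | inj₂ (u , u∈N , u∈x , _)     = ⊥-elim (x-misses u∈N u∈x)
  ... | inj₁ cone@(v∉x , refl , _) = proj₂ ∘ cone-misses-N cone , weight-cone v∉x

  path-misses-N : ∀ {x y} → MissesN x → TransClosure (Step (I G) V) x y → weight y < weight x
  path-misses-N x-misses [ s ] = proj₂ (step-misses-N x-misses s)
  path-misses-N x-misses (s ∷ path) with step-misses-N x-misses s
  ... | z-misses , z<x = <-trans (path-misses-N z-misses path) z<x

  V-acyclic : ∀ σ → ¬ TransClosure (Step (I G) V) σ σ
  V-acyclic σ cycle with any? (λ u → (u ∈? N G v) ×-dec (u ∈? σ))
  ... | yes (u , u∈N , u∈σ) = proj₂ (proj₂ (𝒲-acyclic u u∈N)) _ (proj₂ (path-through u∈N cycle u∈σ))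
  ... | no  ∄u              = <-irrefl refl (path-misses-N (λ {w} w∈N w∈σ → ∄u (w , w∈N , w∈σ)) cycle)

  V-isAcyclicMatching : IsAcyclicMatching (I G) V
  V-isAcyclicMatching =
    All.tabulate (λ {p} p∈V → V-codim (∈V⁻ p∈V)) ,
    pairsDisjoint⇒indexed V V-unique V-disjoint ,
    V-acyclic

  Unmatched𝒲 : Fin n → ℕ → Subset n → Set
  Unmatched𝒲 u = Completion.UnmatchedFace (X u) (𝒱 u) (𝒲 u)

  unmatched𝒲? : ∀ u t → Decidable (Unmatched𝒲 u t)
  unmatched𝒲? u = Completion.unmatchedFace? (X u) (𝒱 u) (𝒲 u)

  CriticalOfSize : ℕ → Subset n → Set
  CriticalOfSize t σ = Critical (I G) V σ × ∣ σ ∣ ≡ suc t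

  IsApex : ℕ → Subset n → Set
  IsApex t σ = t ≡ 0 × σ ≡ insert v ⊥

  LiftedCritical : ℕ → Fin n → Subset n → Set
  LiftedCritical t u σ = u ∈ N G v × u ∈ σ × Unmatched𝒲 u t (remove u σ)

  cone-face : ∀ {σ} → Face (I G) σ → MissesN σ → Face (I G) (insert v σ)
  cone-face (_ , σ-indep) σ-misses =
    (λ _ → x∉p⇒x∈∁p ∉⊥) , insert-independent σ-indep (λ b b∈σ → ¬Adj⇒nonadjacent (λ v~b → σ-misses (∈N⁺ v~b) b∈σ))

  ∣apex∣≡1 : ∣ insert v ⊥ ∣ ≡ 1
  ∣apex∣≡1 = trans (∣insert∣ v ⊥ ∉⊥) (cong suc (∣⊥∣≡0 n))

  ⊥-partner : ∀ {σ} → (⊥ , σ) ∈ₗ V → σ ≡ insert v ⊥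
  ⊥-partner ⊥,σ∈V with ∈V⁻ ⊥,σ∈V
  ... | inj₁ (_ , σ≡v , _)          = σ≡v
  ... | inj₂ (_ , _ , u∈⊥ , _ , _) = ⊥-elim (∉⊥ u∈⊥)

  lifted-unmatched⁺ : ∀ {u σ} → u ∈ N G v → u ∈ σ → Unmatched V σ → Unmatched (𝒲 u) (remove u σ)
  lifted-unmatched⁺ {u} {σ} u∈N u∈σ σ-unmatched = All.tabulate not-in-pair
    where
    not-in-pair : ∀ {p} → p ∈ₗ 𝒲 u → ¬ InPair (remove u σ) p
    not-in-pair {α′ , β′} ∈𝒲 σ-u∈p with 𝒲-codim u∈N ∈𝒲
    ... | α′∈X , β′∈X , _ = All.lookup σ-unmatched (∈V⁺ (inj₂ (u , lifted))) (lift σ-u∈p)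
      where
      u∉ : ∀ {τ} → Face (X u) τ → u ∉ τ
      u∉ τ∈X = Ind-avoids τ∈X (u∈N[u] u)
      lifted : LiftedPair u (insert u α′) (insert u β′)
      lifted = u∈N , x∈insert u α′ , x∈insert u β′ ,
               subst₂ (λ a b → (a , b) ∈ₗ 𝒲 u) (sym (remove-insert u α′ (u∉ α′∈X)))
                                               (sym (remove-insert u β′ (u∉ β′∈X))) ∈𝒲
      lift : InPair (remove u σ) (α′ , β′) → InPair σ (insert u α′ , insert u β′)
      lift (inj₁ refl) = inj₁ (sym (insert-remove u σ u∈σ))
      lift (inj₂ refl) = inj₂ (sym (insert-remove u σ u∈σ))

  lifted-unmatched⁻ : ∀ {u σ} → u ∈ N G v → u ∈ σ → Unmatched (𝒲 u) (remove u σ) → Unmatched V σ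
  lifted-unmatched⁻ {u} {σ} u∈N u∈σ σ-u-unmatched = All.tabulate not-in-pair
    where
    not-in-pair : ∀ {p} → p ∈ₗ V → ¬ InPair σ p
    not-in-pair p∈V σ∈p with ∈V⁻ p∈V
    ... | inj₁ cone = InPair-∉ (cone-misses-N cone u∈N) σ∈p u∈σ
    ... | inj₂ (u′ , lifted@(_ , _ , _ , ∈𝒲)) with u ≟ᶠ u′
    ...   | yes refl = All.lookup σ-u-unmatched ∈𝒲 (InPair-remove σ∈p)
    ...   | no  u≢u′ = InPair-∉ (lifted-misses-N lifted u∈N u≢u′) σ∈p u∈σ

  -- An unmatched σ missing N(v) is impossible: V pairs it with σ ∪ {v} or with σ ∖ {v}.
  critical-misses-N : ∀ {t σ} → CriticalOfSize t σ → MissesN σ → IsApex t σ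
  critical-misses-N {t} {σ} ((_ , σ∈I , inj₂ ⊥,σ∈V) , ∣σ∣≡1+t) _ =
    suc-injective (trans (sym ∣σ∣≡1+t) (trans (cong ∣_∣ (⊥-partner ⊥,σ∈V)) ∣apex∣≡1)) , ⊥-partner ⊥,σ∈V
  critical-misses-N {t} {σ} ((_ , σ∈I , inj₁ σ-unmatched) , _) σ-misses with v ∈? σ
  ... | no  v∉σ = ⊥-elim (All.lookup σ-unmatched (∈V⁺ (inj₁ (v∉σ , refl , cone-face σ∈I σ-misses))) (inj₁ refl))
  ... | yes v∈σ =
    ⊥-elim (All.lookup σ-unmatched (∈V⁺ (inj₁ (x∉remove v σ , sym (insert-remove v σ v∈σ) , σ∈I))) (inj₂ refl))

  ∉apex : ∀ {u} → u ∈ N G v → u ∉ insert v ⊥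
  ∉apex u∈N u∈ with ∈insert⁻ v ⊥ u∈
  ... | inj₁ u≡v = ∈N⇒≢v u∈N u≡v
  ... | inj₂ u∈⊥ = ∉⊥ u∈⊥

  apex∈I : Face (I G) (insert v ⊥)
  apex∈I = cone-face (⊥∈Ind ⊥) (λ _ → ∉⊥)

  critical⇔ : ∀ t σ → CriticalOfSize t σ ⇔ (IsApex t σ ⊎ ∃ λ u → u ∈ N G v × LiftedCritical t u σ)
  critical⇔ t σ = mk⇔ forth back
    where
    forth : CriticalOfSize t σ → IsApex t σ ⊎ ∃ λ u → u ∈ N G v × LiftedCritical t u σ
    forth crit@((_ , σ∈I , status) , ∣σ∣≡1+t) with any? (λ u → (u ∈? N G v) ×-dec (u ∈? σ))
    ... | no  ∄u              = inj₁ (critical-misses-N crit (λ w∈N w∈σ → ∄u (_ , w∈N , w∈σ)))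
    ... | yes (u , u∈N , u∈σ) =
      inj₂ (u , u∈N , u∈N , u∈σ , suc-injective (trans (sym (∣remove∣ u σ u∈σ)) ∣σ∣≡1+t) ,
            remove-face σ∈I u∈σ , unmatched status)
      where
      unmatched : Unmatched V σ ⊎ (⊥ , σ) ∈ₗ V → Unmatched (𝒲 u) (remove u σ)
      unmatched (inj₁ σ-unmatched) = lifted-unmatched⁺ u∈N u∈σ σ-unmatched
      unmatched (inj₂ ⊥,σ∈V)       = ⊥-elim (∉apex u∈N (subst (u ∈_) (⊥-partner ⊥,σ∈V) u∈σ))
    back : IsApex t σ ⊎ ∃ (λ u → u ∈ N G v × LiftedCritical t u σ) → CriticalOfSize t σ
    back (inj₁ (refl , refl)) =
      ((λ eq → ∉⊥ (subst (v ∈_) eq (x∈insert v ⊥))) , apex∈I , inj₂ (∈V⁺ (inj₁ (∉⊥ , refl , apex∈I)))) , ∣apex∣≡1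
    back (inj₂ (u , _ , u∈N , u∈σ , ∣σ-u∣≡t , σ-u∈X , σ-u-unmatched)) =
      ((λ { refl → ∉⊥ u∈σ }) , subst (Face (I G)) (insert-remove u σ u∈σ) (insert-face σ-u∈X) ,
       inj₁ (lifted-unmatched⁻ u∈N u∈σ σ-u-unmatched)) ,
      trans (∣remove∣ u σ u∈σ) (cong suc ∣σ-u∣≡t)

  apex? : ∀ t → Decidable (IsApex t)
  apex? t σ = (t ≟ℕ 0) ×-dec (σ ≟ˢ insert v ⊥)

  liftedCritical? : ∀ t u → Decidable (LiftedCritical t u)
  liftedCritical? t u σ = (u ∈? N G v) ×-dec (u ∈? σ) ×-dec unmatched𝒲? u t (remove u σ)

  lifted-disjoint : ∀ {t u u′} σ → LiftedCritical t u σ → LiftedCritical t u′ σ → u ≡ u′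
  lifted-disjoint {u = u} {u′} σ (u∈N , _ , _ , σ-u∈X , _) (u′∈N , u′∈σ , _) with u ≟ᶠ u′
  ... | yes u≡u′ = u≡u′
  ... | no  u≢u′ = ⊥-elim (X-avoids-N[v] u∈N σ-u∈X (N⊆N[] u′∈N) (∈remove⁺ u σ (u≢u′ ∘ sym) u′∈σ))

  f-V : ∀ t → f (I G) V t ≡ countSub n (apex? t) + sumOver (N G v) (λ u → countSub n (unmatched𝒲? u t))
  f-V t = begin
    f (I G) V t
      ≡⟨ countSub-⊎ n _ (apex? t) lifted? (critical⇔ t) apex∩lifted=∅ ⟩
    countSub n (apex? t) + countSub n lifted?
      ≡⟨ cong (_+_ (countSub n (apex? t)))
              (countSub-∃ n (N G v) (liftedCritical? t) lifted? (λ σ → mk⇔ id id) lifted-disjoint) ⟩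
    countSub n (apex? t) + sumOver (N G v) (λ u → countSub n (liftedCritical? t u))
      ≡⟨ cong (_+_ (countSub n (apex? t))) (sumOver-cong (N G v) count-lifted) ⟩
    countSub n (apex? t) + sumOver (N G v) (λ u → countSub n (unmatched𝒲? u t))
      ∎
    where
    open ≡-Reasoning
    lifted? : Decidable (λ σ → ∃ λ u → u ∈ N G v × LiftedCritical t u σ)
    lifted? σ = any? (λ u → (u ∈? N G v) ×-dec liftedCritical? t u σ)
    apex∩lifted=∅ : ∀ σ → IsApex t σ → ¬ ∃ (λ u → u ∈ N G v × LiftedCritical t u σ)
    apex∩lifted=∅ σ (_ , refl) (u , u∈N , _ , u∈σ , _) = ∉apex u∈N u∈σ
    count-lifted : ∀ u → u ∈ N G v → countSub n (liftedCritical? t u) ≡ countSub n (unmatched𝒲? u t)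
    count-lifted u u∈N =
      countSub-insert n u _ _ (λ σ → mk⇔ proj₂ (u∈N ,_)) (λ τ (_ , τ∈X , _) → Ind-avoids τ∈X (u∈N[u] u))

  hasVertex? : ∀ u → Dec (Completion.HasVertex (X u) (𝒱 u))
  hasVertex? u = Completion.hasVertex? (X u) (𝒱 u)

  apex-count-0 : countSub n (apex? 0) ≡ 1
  apex-count-0 = trans (countSub-cong n _ (_≟ˢ insert v ⊥) (λ σ → mk⇔ proj₂ (refl ,_))) (countSub-≡ n (insert v ⊥))

  apex-count-suc : ∀ t → countSub n (apex? (suc t)) ≡ 0
  apex-count-suc t = countSub-∅ n _ (λ σ (1+t≡0 , _) → 0≢1+n (sym 1+t≡0))

  #universal≡sumOver : ¬ Universal G v → countFin (universal? G) ≡ sumOver (N G v) (indicator ∘ universal? G)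
  #universal≡sumOver v-not-universal =
    trans (countFin≡sumOver (universal? G))
          (sumOver-⊤ (N G v) _ (λ u u∉N → indicator-no (universal? G u) (u∉N ∘ universal⇒∈N v-not-universal)))

  count-0 : ∀ u → u ∈ N G v → countSub n (unmatched𝒲? u 0) ≡ indicator (universal? G u)
  count-0 u u∈N = trans (Completed.unmatched-0 u u∈N) (indicator-⇔ _ _ (⇔-sym (universal⇔no-vertex u)))

  universal+hasVertex≡1 : ∀ u → indicator (universal? G u) + indicator (hasVertex? u) ≡ 1
  universal+hasVertex≡1 u =
    trans (cong (_+ indicator (hasVertex? u)) (indicator-⇔ _ (¬? (hasVertex? u)) (universal⇔no-vertex u)))
          (indicator-¬ (hasVertex? u))

  f-V-0 : ¬ Universal G v → f (I G) V 0 ≡ 1 + countFin (universal? G)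
  f-V-0 v-not-universal = begin
    f (I G) V 0
      ≡⟨ f-V 0 ⟩
    countSub n (apex? 0) + sumOver (N G v) (λ u → countSub n (unmatched𝒲? u 0))
      ≡⟨ cong₂ _+_ apex-count-0 (sumOver-cong (N G v) count-0) ⟩
    1 + sumOver (N G v) (indicator ∘ universal? G)
      ≡⟨ cong suc (sym (#universal≡sumOver v-not-universal)) ⟩
    1 + countFin (universal? G)
      ∎
    where open ≡-Reasoning

  f-V-1 : ¬ Universal G v →
          + f (I G) V 1 ≡ + sumOver (N G v) (λ u → f (X u) (𝒱 u) 0) - (+ ∣ N G v ∣ - + countFin (universal? G))
  f-V-1 v-not-universal = begin
    + f (I G) V 1                  ≡⟨ cong +_ (trans (f-V 1) (cong (_+ A) (apex-count-suc 0))) ⟩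
    + A                            ≡⟨ +a≡+[a+b]-[+[k+b]-+k] A B K ⟩
    + (A + B) - (+ (K + B) - + K)  ≡⟨ cong₂ (λ s m → + s - (+ m - + K)) A+B≡Σf₀ K+B≡∣N∣ ⟩
    + Σf₀ - (+ ∣ N G v ∣ - + K)    ≡⟨ cong (λ k → + Σf₀ - (+ ∣ N G v ∣ - + k)) K≡k ⟩
    + Σf₀ - (+ ∣ N G v ∣ - + countFin (universal? G)) ∎
    where
    open ≡-Reasoning
    A B K Σf₀ : ℕ
    A   = sumOver (N G v) (λ u → countSub n (unmatched𝒲? u 1))
    B   = sumOver (N G v) (indicator ∘ hasVertex?)
    K   = sumOver (N G v) (indicator ∘ universal? G)
    Σf₀ = sumOver (N G v) (λ u → f (X u) (𝒱 u) 0)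
    A+B≡Σf₀ : A + B ≡ Σf₀
    A+B≡Σf₀ = trans (sym (sumOver-+ (N G v) _ _)) (sumOver-cong (N G v) Completed.unmatched-1)
    K≡k : K ≡ countFin (universal? G)
    K≡k = sym (#universal≡sumOver v-not-universal)
    K+B≡∣N∣ : K + B ≡ ∣ N G v ∣
    K+B≡∣N∣ = trans (sym (sumOver-+ (N G v) _ _))
                    (trans (sumOver-cong (N G v) (λ u _ → universal+hasVertex≡1 u)) (sym (∣S∣≡sumOver-1 (N G v))))

  f-V-≥2 : ∀ t → 2 ≤ t → f (I G) V t ≡ sumOver (N G v) (λ u → f (X u) (𝒱 u) (t ∸ 1))
  f-V-≥2 (suc (suc t)) _ =
    trans (f-V (suc (suc t)))
          (cong₂ _+_ (apex-count-suc (suc t)) (sumOver-cong (N G v) (λ u u∈N → Completed.unmatched-≥2 u u∈N t)))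
  f-V-≥2 1 (s≤s ())

-- Connected components of I(G)

index-unique : ∀ {A : Set} {x : A} {xs} → Unique xs → (p q : x ∈ₗ xs) → index p ≡ index q
index-unique (_   ∷ _) (Any.here refl) (Any.here refl) = refl
index-unique (x∉ ∷ _) (Any.here refl) (Any.there q)   = ⊥-elim (All.lookup x∉ q refl)
index-unique (x∉ ∷ _) (Any.there p)   (Any.here refl) = ⊥-elim (All.lookup x∉ p refl)
index-unique (_   ∷ u) (Any.there p)   (Any.there q)   = cong suc (index-unique u p q)

index-∈-lookup : ∀ {A : Set} (xs : List A) i → index (∈-lookup {xs = xs} i) ≡ i
index-∈-lookup (x ∷ xs) zero    = refl
index-∈-lookup (x ∷ xs) (suc i) = cong suc (index-∈-lookup xs i)

module Components {n : ℕ} (G : Graph n) (v : Fin n) (v-not-universal : ¬ Universal G v)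
                  (N[v]-clique : IsClique G N[ G , v ]) where

  open GraphProperties G

  Link : Fin n → Fin n → Set
  Link = Linked (I G)

  ∈pair⁻ : ∀ {x y a : Fin n} → a ∈ ⁅ x ⁆ ∪ ⁅ y ⁆ → a ≡ x ⊎ a ≡ y
  ∈pair⁻ {x} {y} a∈ with x∈p∪q⁻ ⁅ x ⁆ ⁅ y ⁆ a∈
  ... | inj₁ a∈x = inj₁ (x∈⁅y⁆⇒x≡y x a∈x)
  ... | inj₂ a∈y = inj₂ (x∈⁅y⁆⇒x≡y y a∈y)

  nonadjacent⇒link : ∀ {x y} → adj G x y ≡ false → Link x y
  nonadjacent⇒link {x} {y} x≁y = (λ _ → x∉p⇒x∈∁p ∉⊥) , λ a b a∈ b∈ → pair-indep (∈pair⁻ a∈) (∈pair⁻ b∈)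
    where
    pair-indep : ∀ {a b} → a ≡ x ⊎ a ≡ y → b ≡ x ⊎ b ≡ y → adj G a b ≡ false
    pair-indep (inj₁ refl) (inj₁ refl) = irrefl G x
    pair-indep (inj₁ refl) (inj₂ refl) = x≁y
    pair-indep (inj₂ refl) (inj₁ refl) = trans (symm G y x) x≁y
    pair-indep (inj₂ refl) (inj₂ refl) = irrefl G y

  link⇒nonadjacent : ∀ {x y} → Link x y → adj G x y ≡ false
  link⇒nonadjacent {x} {y} (_ , indep) = indep x y (x∈p∪q⁺ (inj₁ (x∈⁅x⁆ x))) (x∈p∪q⁺ (inj₂ (x∈⁅x⁆ y)))

  link-sym : ∀ {x y} → Link x y → Link y x
  link-sym {x} {y} = nonadjacent⇒link ∘ trans (symm G y x) ∘ link⇒nonadjacent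

  link⇒¬universal : ∀ {x y} → Link x y → x ≢ y → ¬ Universal G x
  link⇒¬universal x~y x≢y x-universal with () ← trans (sym (x-universal _ (x≢y ∘ sym))) (link⇒nonadjacent x~y)

  ¬universal⇒nonneighbour : ∀ {x} → ¬ Universal G x → ∃ λ w → w ≢ x × adj G x w ≡ false
  ¬universal⇒nonneighbour {x} x-not-universal with any? (λ w → ¬? (w ≟ᶠ x) ×-dec (adj G x w ≟ᵇ false))
  ... | yes w = w
  ... | no ∄w = ⊥-elim (x-not-universal (λ w w≢x → ¬-not (λ x≁w → ∄w (w , w≢x , x≁w))))

  -- A non-universal x misses some w; if x ~ v, then w ≁ v since N[v] is a clique, so v - w - x in I(G).
  v-reaches-¬universal : ∀ {x} → ¬ Universal G x → Star Link v x
  v-reaches-¬universal {x} x-not-universal with adj G v x in v~x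
  ... | false = nonadjacent⇒link v~x ◅ ε
  ... | true with ¬universal⇒nonneighbour x-not-universal
  ...   | w , w≢x , x≁w = nonadjacent⇒link v≁w ◅ link-sym (nonadjacent⇒link x≁w) ◅ ε
    where
    v≁w : adj G v w ≡ false
    v≁w with adj G v w in v~w
    ... | false = refl
    ... | true with () ← trans (sym (N[v]-clique x w (∈N[]⁺ v~x) (∈N[]⁺ v~w) (w≢x ∘ sym))) x≁w

  universals : List (Fin n)
  universals = filter (universal? G) (allFin n)

  universals-unique : Unique universals
  universals-unique = Unique.filter⁺ (universal? G) (Unique.allFin⁺ n)

  -- Component 0 holds v and every non-universal vertex; each universal vertex is isolated in I(G)
  -- and gets its own component, numbered by its position in the list of universal vertices.
  component : Fin n → Fin (suc (countFin (universal? G)))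
  component x with universal? G x
  ... | yes x-universal = suc (index (∈-filter⁺ (universal? G) (∈-allFin x) x-universal))
  ... | no  _           = zero

  component-¬universal : ∀ {x} → ¬ Universal G x → component x ≡ zero
  component-¬universal {x} x-not-universal with universal? G x
  ... | yes x-universal = ⊥-elim (x-not-universal x-universal)
  ... | no  _           = refl

  link⇒same-component : ∀ {x y} → Link x y → component x ≡ component y
  link⇒same-component {x} {y} x~y with x ≟ᶠ y
  ... | yes refl = refl
  ... | no  x≢y  = trans (component-¬universal (link⇒¬universal x~y x≢y))
                         (sym (component-¬universal (link⇒¬universal (link-sym x~y) (x≢y ∘ sym))))

  reachable⇒same-component : ∀ {x y} → Star Link x y → component x ≡ component y
  reachable⇒same-component ε            = refl
  reachable⇒same-component (x~z ◅ path) = trans (link⇒same-component x~z) (reachable⇒same-component path)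

  same-component⇒reachable : ∀ {x y} → component x ≡ component y → Star Link x y
  same-component⇒reachable {x} {y} same with universal? G x | universal? G y
  ... | yes _               | yes _ with index-injective (setoid (Fin n)) _ _ (Finₚ.suc-injective same)
  ...   | refl = ε
  same-component⇒reachable same | no x-not-universal | no y-not-universal =
    reverse link-sym (v-reaches-¬universal x-not-universal) ◅◅ v-reaches-¬universal y-not-universal

  component-surjective : ∀ i → ∃ λ x → component x ≡ i
  component-surjective zero    = v , component-¬universal v-not-universal
  component-surjective (suc i) = lookup universals i , same-index
    where
    x : Fin n
    x = lookup universals i
    x-universal : Universal G x
    x-universal = All.lookup (all-filter (universal? G) (allFin n)) (∈-lookup i)
    same-index : component x ≡ suc i
    same-index with universal? G x
    ... | yes _ = cong suc (trans (index-unique universals-unique _ (∈-lookup i)) (index-∈-lookup universals i))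
    ... | no  x-not-universal = ⊥-elim (x-not-universal x-universal)

  hasComponents : HasComponents (I G) (suc (countFin (universal? G)))
  hasComponents =
    component ,
    (λ x y _ _ → mk⇔ same-component⇒reachable reachable⇒same-component) ,
    (λ i → let x , x↦i = component-surjective i in x , vertex∈Ind ⊥ ∉⊥ , x↦i)

theorem1p1 : ∀ {n : ℕ} (G : Graph n) (v : Fin n) →
    ⁅ v ⁆ ⊂ N[ G , v ] → N[ G , v ] ⊂ ⊤ → IsClique G N[ G , v ] →
    (𝒱 : Fin n → Matching n) →
    (∀ u → u ∈ N G v → IsAcyclicMatching I[ G - N[ G , u ] ] (𝒱 u)) →
    Σ (Matching n) λ V →
      IsAcyclicMatching (I G) V
      × (f (I G) V 0 ≡ 1 Data.Nat.+ countFin (universal? G)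
         × HasComponents (I G) (1 Data.Nat.+ countFin (universal? G)))
      × (+ f (I G) V 1
          ≡ + sumOver (N G v) (λ u → f I[ G - N[ G , u ] ] (𝒱 u) 0)
            - (+ ∣ N G v ∣ - + countFin (universal? G)))
      × (∀ (t : ℕ) → 2 ≤ t →
          f (I G) V t ≡ sumOver (N G v) (λ u → f I[ G - N[ G , u ] ] (𝒱 u) (t ∸ 1)))
theorem1p1 G v _ N[v]⊂⊤ N[v]-clique 𝒱 𝒱-acyclic =
  V , V-isAcyclicMatching , (f-V-0 v-not-universal , hasComponents) , f-V-1 v-not-universal , f-V-≥2
  where
  v-not-universal : ¬ Universal G v
  v-not-universal = GraphProperties.N[]⊂⊤⇒¬universal G N[v]⊂⊤
  open Construction G v N[v]-clique 𝒱 𝒱-acyclic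
  open Components G v v-not-universal N[v]-clique
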